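{- For all $k \ge 1$, $$\sum_{n=0}^\infty |\mathfrak{S}_n(1243, 2143, 12\cdots k)|\, x^n = 1 + \frac{\sqrt{x}\, U_{k-2}\!\left(\frac{1-x}{2\sqrt{x}}\right)}{U_{k-1}\!\left(\frac{1-x}{2\sqrt{x}}\right)}$$ and $$\sum_{n=0}^\infty |\mathfrak{S}_n(1243, 2143, 213\cdots k)|\, x^n = 1 + \frac{\sqrt{x}\, U_{k-2}\!\left(\frac{1-x}{2\sqrt{x}}\right)}{U_{k-1}\!\left(\frac{1-x}{2\sqrt{x}}\right)}.$$
   Context: A permutation avoids a pattern $\sigma$ if it has no subsequence with the same relative order as $\sigma$; $\mathfrak{S}_n(R)$ is the set of permutations of $\{1,\dots,n\}$ avoiding every pattern in $R$. $12\cdots k$ is the identity permutation of length $k$, and $213\cdots k$ is the permutation $2,1,3,4,\dots,k$ (for $k=2$ it is $21$, and for $k=1$ it is read as the permutation $1$). $U_n$ is the $n$th Chebyshev polynomial of the second kind: $U_{ -1}=0$ and $U_n(\cos t) = \sin((n+1)t)/\sin t$ for $n \ge 0$; equivalently $U_0 = 1$, $U_1(y)=2y$, $U_n(y) = 2yU_{n-1}(y) - U_{n-2}(y)$. -}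

module Defs where

open import Data.Bool using (Bool; true; false; not; _∧_; _∨_; if_then_else_)
open import Data.Nat using (ℕ; zero; suc; _∸_; _<ᵇ_; _≡ᵇ_)
open import Data.Integer using (ℤ; +_; _+_; _-_; _*_)
open import Data.List using (List; []; _∷_; map; length; filterᵇ; concatMap; upTo)
open import Data.Bool.ListAction using (all; any)
open import Data.Product using (_×_; _,_)

-- Permutations of {1,…,n} as lists (one-line notation).

words : ℕ → ℕ → List (List ℕ)
words zero    n = [] ∷ []
words (suc m) n = concatMap (λ a → map (a ∷_) (words m n)) (map suc (upTo n))

distinct : List ℕ → Bool
distinct []       = true
distinct (a ∷ as) = all (λ b → not (a ≡ᵇ b)) as ∧ distinct as

perms : ℕ → List (List ℕ)
perms n = filterᵇ distinct (words n n)

subseqs : {A : Set} → List A → List (List A)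
subseqs []       = [] ∷ []
subseqs (a ∷ as) = map (a ∷_) (subseqs as) ++' subseqs as
  where
  _++'_ : {B : Set} → List B → List B → List B
  [] ++' ys = ys
  (x ∷ xs) ++' ys = x ∷ (xs ++' ys)

sameLength : List ℕ → List ℕ → Bool
sameLength []       []       = true
sameLength (_ ∷ s)  (_ ∷ t)  = sameLength s t
sameLength _        _        = false

zipL : List ℕ → List ℕ → List (ℕ × ℕ)
zipL (a ∷ s) (b ∷ t) = (a , b) ∷ zipL s t
zipL _       _       = []

_==ᵇ_ : Bool → Bool → Bool
true  ==ᵇ b = b
false ==ᵇ b = not b

pairsOK : List (ℕ × ℕ) → Bool
pairsOK []             = true
pairsOK ((a , b) ∷ ps) =
  all (λ { (c , d) → (a <ᵇ c) ==ᵇ (b <ᵇ d) }) ps ∧ pairsOK ps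

orderIso : List ℕ → List ℕ → Bool
orderIso s σ = sameLength s σ ∧ pairsOK (zipL s σ)

contains : List ℕ → List ℕ → Bool
contains π σ = any (λ s → orderIso s σ) (subseqs π)

avoidsAll : List (List ℕ) → List ℕ → Bool
avoidsAll R π = all (λ σ → not (contains π σ)) R

countAvoiders : List (List ℕ) → ℕ → ℕ
countAvoiders R n = length (filterᵇ (avoidsAll R) (perms n))

p1243 : List ℕ
p1243 = 1 ∷ 2 ∷ 4 ∷ 3 ∷ []

p2143 : List ℕ
p2143 = 2 ∷ 1 ∷ 4 ∷ 3 ∷ []

incr : ℕ → List ℕ
incr k = map suc (upTo k)

p213 : ℕ → List ℕ
p213 zero                = []
p213 (suc zero)          = 1 ∷ []
p213 (suc (suc k))       = 2 ∷ 1 ∷ map (λ i → suc (suc (suc i))) (upTo k)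

Series : Set
Series = ℕ → ℤ

convAux : Series → Series → ℕ → ℕ → ℤ
convAux f g n zero    = f 0 * g n
convAux f g n (suc i) = f (suc i) * g (n ∸ suc i) + convAux f g n i

conv : Series → Series → Series
conv f g n = convAux f g n n

shift : Series → Series
shift f zero    = + 0
shift f (suc n) = f n

minusOne : Series → Series
minusOne f zero    = f 0 - + 1
minusOne f (suc n) = f (suc n)

gf : (ℕ → ℕ) → Series
gf a n = + (a n)

-- Chebyshev polynomials after the substitution y = (1-x)/(2√x):
--   chebQ (m+1) = x^{m/2} U_m((1-x)/(2√x))   (m ≥ 0),   chebQ 0 = U_{-1} = 0.
-- From U_m(y) = 2y U_{m-1}(y) - U_{m-2}(y) one gets
--   chebQ (m+2) = (1-x) chebQ (m+1) - x chebQ m,  chebQ 1 = 1, chebQ 0 = 0,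
-- which is a polynomial in x with integer coefficients.
chebQ : ℕ → Series
chebQ zero                  n       = + 0
chebQ (suc zero)            zero    = + 1
chebQ (suc zero)            (suc n) = + 0
chebQ (suc (suc m))         n       =
  (chebQ (suc m) n - shift (chebQ (suc m)) n) - shift (chebQ m) n

-- Write a permutation π avoiding 1243, 2143 and σ = σ₀ ∷ʳ y, where y exceeds every entry of σ₀, as
-- α ++ N ∷ β with N its maximum. If α = [] then π avoids these patterns iff β does. Otherwise, as π has
-- no entries a, b, c, d in this order with a, b < d < c, every entry of α other than its minimum M exceeds
-- every entry of β; so M ∷ β consists of the values 1, …, |β| + 1, and π avoids the patterns iff the
-- standardisation of α avoids 1243, 2143, σ₀ and M ∷ β avoids 1243, 2143, σ. Counting this bijection,
-- for σ = 12⋯k and for σ = 213⋯k the series A_k = F_k − 1, with F_k the generating function of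
-- 𝔖_n(1243, 2143, σ), satisfy
--   A₁ = 0,   A_k = x + x A_k + A_{k−1} A_k  (k ≥ 2)
-- (for 213⋯k with k = 2 directly: only the identity avoids 21). As the Chebyshev terms satisfy
-- Q_{k+1} = (1 − x) Q_k − x Q_{k−1}, induction on k gives A_k Q_k = x Q_{k−1}.
module Submission where

open import Defs
open import Data.Nat using (ℕ; _≤_; _∸_)
open import Data.List using (List; []; _∷_)
open import Data.Product using (_×_)
open import Relation.Binary.PropositionalEquality using (_≡_)

module PowerSeries where

  open import Data.Nat as ℕ using (zero; suc)
  import Data.Nat.Properties as ℕ
  open import Data.Nat.ListAction using (sum)
  open import Data.List using (map; downFrom)
  open import Data.Integer using (ℤ; +_; _+_; _-_; _*_)
  import Data.Integer.Properties as ℤ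
  open import Data.Integer.Solver using (module +-*-Solver)
  open import Relation.Binary.PropositionalEquality using (refl; sym; trans; cong; cong₂; module ≡-Reasoning)

  open +-*-Solver

  infix 4 _≈_
  infixl 6 _⊕_ _⊖_

  _≈_ : Series → Series → Set
  f ≈ g = ∀ n → f n ≡ g n

  tail : Series → Series
  tail f n = f (suc n)

  _⊕_ : Series → Series → Series
  (f ⊕ g) n = f n + g n

  _⊖_ : Series → Series → Series
  (f ⊖ g) n = f n - g n

  scale : ℤ → Series → Series
  scale c f n = c * f n

  𝟘 : Series
  𝟘 _ = + 0

  𝟙 : Series
  𝟙 zero    = + 1
  𝟙 (suc _) = + 0

  convAux-suc : ∀ f g n j → convAux f g (suc n) (suc j) ≡ f 0 * g (suc n) + convAux (tail f) g n j
  convAux-suc f g n zero    = ℤ.+-comm (f 1 * g n) (f 0 * g (suc n))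
  convAux-suc f g n (suc j) rewrite convAux-suc f g n j =
    solve 3 (λ a b c → a :+ (b :+ c) := b :+ (a :+ c)) refl
      (f (suc (suc j)) * g (n ℕ.∸ suc j)) (f 0 * g (suc n)) (convAux (tail f) g n j)

  conv-suc : ∀ f g n → conv f g (suc n) ≡ f 0 * g (suc n) + conv (tail f) g n
  conv-suc f g n = convAux-suc f g n n

  conv-cong : ∀ {f f′ g g′} → f ≈ f′ → g ≈ g′ → conv f g ≈ conv f′ g′
  conv-cong f≈ g≈ zero = cong₂ _*_ (f≈ 0) (g≈ 0)
  conv-cong {f} {f′} {g} {g′} f≈ g≈ (suc n) rewrite conv-suc f g n | conv-suc f′ g′ n =
    cong₂ _+_ (cong₂ _*_ (f≈ 0) (g≈ (suc n))) (conv-cong (λ m → f≈ (suc m)) g≈ n)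

  conv-comm : ∀ f g → conv f g ≈ conv g f
  conv-comm f g zero       = ℤ.*-comm (f 0) (g 0)
  conv-comm f g (suc zero) rewrite conv-suc f g 0 | conv-suc g f 0 =
    solve 4 (λ a b c d → a :* b :+ c :* d := d :* c :+ b :* a) refl (f 0) (g 1) (f 1) (g 0)
  conv-comm f g (suc m@(suc n)) = begin
    conv f g (suc m)
      ≡⟨ conv-suc f g m ⟩
    f 0 * g (suc m) + conv (tail f) g m
      ≡⟨ cong (λ c → f 0 * g (suc m) + c) (trans (conv-comm (tail f) g m) (conv-suc g (tail f) n)) ⟩
    f 0 * g (suc m) + (g 0 * f (suc m) + conv (tail g) (tail f) n)
      ≡⟨ cong (λ c → f 0 * g (suc m) + (g 0 * f (suc m) + c)) (conv-comm (tail g) (tail f) n) ⟩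
    f 0 * g (suc m) + (g 0 * f (suc m) + conv (tail f) (tail g) n)
      ≡⟨ solve 5 (λ a b c d e → a :* b :+ (c :* d :+ e) := c :* d :+ (a :* b :+ e)) refl
                 (f 0) (g (suc m)) (g 0) (f (suc m)) (conv (tail f) (tail g) n) ⟩
    g 0 * f (suc m) + (f 0 * g (suc m) + conv (tail f) (tail g) n)
      ≡⟨ cong (λ c → g 0 * f (suc m) + c) (sym (trans (conv-comm (tail g) f m) (conv-suc f (tail g) n))) ⟩
    g 0 * f (suc m) + conv (tail g) f m
      ≡⟨ sym (conv-suc g f m) ⟩
    conv g f (suc m) ∎
    where open ≡-Reasoning

  conv-distribʳ-⊕ : ∀ f f′ g → conv (f ⊕ f′) g ≈ conv f g ⊕ conv f′ g
  conv-distribʳ-⊕ f f′ g zero    = ℤ.*-distribʳ-+ (g 0) (f 0) (f′ 0)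
  conv-distribʳ-⊕ f f′ g (suc n)
    rewrite conv-suc (f ⊕ f′) g n | conv-suc f g n | conv-suc f′ g n | conv-distribʳ-⊕ (tail f) (tail f′) g n =
    solve 5 (λ a b c d e → (a :+ b) :* c :+ (d :+ e) := a :* c :+ d :+ (b :* c :+ e)) refl
      (f 0) (f′ 0) (g (suc n)) (conv (tail f) g n) (conv (tail f′) g n)

  conv-distribʳ-⊖ : ∀ f f′ g → conv (f ⊖ f′) g ≈ conv f g ⊖ conv f′ g
  conv-distribʳ-⊖ f f′ g zero    =
    solve 3 (λ a b c → (a :- b) :* c := a :* c :- b :* c) refl (f 0) (f′ 0) (g 0)
  conv-distribʳ-⊖ f f′ g (suc n)
    rewrite conv-suc (f ⊖ f′) g n | conv-suc f g n | conv-suc f′ g n | conv-distribʳ-⊖ (tail f) (tail f′) g n =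
    solve 5 (λ a b c d e → (a :- b) :* c :+ (d :- e) := a :* c :+ d :- (b :* c :+ e)) refl
      (f 0) (f′ 0) (g (suc n)) (conv (tail f) g n) (conv (tail f′) g n)

  conv-scaleˡ : ∀ c f g → conv (scale c f) g ≈ scale c (conv f g)
  conv-scaleˡ c f g zero    = ℤ.*-assoc c (f 0) (g 0)
  conv-scaleˡ c f g (suc n) rewrite conv-suc (scale c f) g n | conv-suc f g n | conv-scaleˡ c (tail f) g n =
    solve 4 (λ c a b d → c :* a :* b :+ c :* d := c :* (a :* b :+ d)) refl c (f 0) (g (suc n)) (conv (tail f) g n)

  conv-shiftˡ : ∀ f g → conv (shift f) g ≈ shift (conv f g)
  conv-shiftˡ f g zero    = refl
  conv-shiftˡ f g (suc n) rewrite conv-suc (shift f) g n = ℤ.+-identityˡ (conv f g n)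

  conv-zeroˡ : ∀ {f} g → f ≈ 𝟘 → conv f g ≈ 𝟘
  conv-zeroˡ {f} g f≈0 zero    rewrite f≈0 0 = refl
  conv-zeroˡ {f} g f≈0 (suc n) rewrite conv-suc f g n | f≈0 0 | conv-zeroˡ g (λ m → f≈0 (suc m)) n = refl

  conv-identityˡ : ∀ g → conv 𝟙 g ≈ g
  conv-identityˡ g zero    = ℤ.*-identityˡ (g 0)
  conv-identityˡ g (suc n) rewrite conv-suc 𝟙 g n | conv-zeroˡ {tail 𝟙} g (λ _ → refl) n =
    trans (ℤ.+-identityʳ (+ 1 * g (suc n))) (ℤ.*-identityˡ (g (suc n)))

  conv-assoc : ∀ f g h → conv (conv f g) h ≈ conv f (conv g h)
  conv-assoc f g h zero    = ℤ.*-assoc (f 0) (g 0) (h 0)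
  conv-assoc f g h (suc n) = begin
    conv (conv f g) h (suc n)
      ≡⟨ conv-suc (conv f g) h n ⟩
    f 0 * g 0 * h (suc n) + conv (tail (conv f g)) h n
      ≡⟨ cong (λ c → f 0 * g 0 * h (suc n) + c) (conv-cong (conv-suc f g) (λ _ → refl) n) ⟩
    f 0 * g 0 * h (suc n) + conv (scale (f 0) (tail g) ⊕ conv (tail f) g) h n
      ≡⟨ cong (λ c → f 0 * g 0 * h (suc n) + c) (trans (conv-distribʳ-⊕ (scale (f 0) (tail g)) (conv (tail f) g) h n)
                                                 (cong₂ _+_ (conv-scaleˡ (f 0) (tail g) h n) (conv-assoc (tail f) g h n))) ⟩
    f 0 * g 0 * h (suc n) + (f 0 * conv (tail g) h n + conv (tail f) (conv g h) n)
      ≡⟨ solve 5 (λ a b c d e → a :* b :* c :+ (a :* d :+ e) := a :* (b :* c :+ d) :+ e) refl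
                 (f 0) (g 0) (h (suc n)) (conv (tail g) h n) (conv (tail f) (conv g h) n) ⟩
    f 0 * (g 0 * h (suc n) + conv (tail g) h n) + conv (tail f) (conv g h) n
      ≡⟨ cong (λ c → f 0 * c + conv (tail f) (conv g h) n) (sym (conv-suc g h n)) ⟩
    f 0 * conv g h (suc n) + conv (tail f) (conv g h) n
      ≡⟨ sym (conv-suc f (conv g h) n) ⟩
    conv f (conv g h) (suc n) ∎
    where open ≡-Reasoning

  shift-cong : ∀ {f g} → f ≈ g → shift f ≈ shift g
  shift-cong f≈g zero    = refl
  shift-cong f≈g (suc n) = f≈g n

  module _ (A : ℕ → Series) (A₁≈𝟘 : A 1 ≈ 𝟘)
           (A-rec : ∀ k → A (suc (suc k)) ≈ shift 𝟙 ⊕ shift (A (suc (suc k))) ⊕ conv (A (suc k)) (A (suc (suc k))))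
           where

    conv-chebQ : ∀ k → conv (A (suc k)) (chebQ (suc k)) ≈ shift (chebQ k)
    conv-chebQ zero    n = trans (conv-zeroˡ (chebQ 1) A₁≈𝟘 n) (sym (shift-chebQ₀ n))
      where
      shift-chebQ₀ : shift (chebQ 0) ≈ 𝟘
      shift-chebQ₀ zero    = refl
      shift-chebQ₀ (suc _) = refl
    conv-chebQ (suc k) n = begin
      conv A″ Q₂ n                               ≡⟨ conv-A″-Q₂ ⟩
      W n - shift W n - conv A′ W n              ≡⟨ cong (λ w → w - shift W n - conv A′ W n) W-unfold ⟩
      shift Q₁ n + shift W n + conv A′ W n - shift W n - conv A′ W n
        ≡⟨ solve 3 (λ q w v → q :+ w :+ v :- w :- v := q) refl (shift Q₁ n) (shift W n) (conv A′ W n) ⟩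
      shift Q₁ n                                 ∎
      where
      open ≡-Reasoning
      A′ A″ Q₀ Q₁ Q₂ W : Series
      A′ = A (suc k)
      A″ = A (suc (suc k))
      Q₀ = chebQ k
      Q₁ = chebQ (suc k)
      Q₂ = chebQ (suc (suc k))
      W  = conv Q₁ A″

      -- the induction hypothesis x Q₀ = A′ Q₁, multiplied by A″
      shiftQ₀-A″ : conv (shift Q₀) A″ n ≡ conv A′ W n
      shiftQ₀-A″ = trans (conv-cong (λ m → sym (conv-chebQ k m)) (λ _ → refl) n) (conv-assoc A′ Q₁ A″ n)

      conv-A″-Q₂ : conv A″ Q₂ n ≡ W n - shift W n - conv A′ W n
      conv-A″-Q₂ = begin
        conv A″ Q₂ n
          ≡⟨ conv-comm A″ Q₂ n ⟩
        conv (Q₁ ⊖ shift Q₁ ⊖ shift Q₀) A″ n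
          ≡⟨ conv-distribʳ-⊖ (Q₁ ⊖ shift Q₁) (shift Q₀) A″ n ⟩
        conv (Q₁ ⊖ shift Q₁) A″ n - conv (shift Q₀) A″ n
          ≡⟨ cong₂ _-_ (conv-distribʳ-⊖ Q₁ (shift Q₁) A″ n) shiftQ₀-A″ ⟩
        W n - conv (shift Q₁) A″ n - conv A′ W n
          ≡⟨ cong (λ w → W n - w - conv A′ W n) (conv-shiftˡ Q₁ A″ n) ⟩
        W n - shift W n - conv A′ W n ∎

      -- W = Q₁ A″ expanded with the recurrence A″ = x + x A″ + A′ A″
      W-unfold : W n ≡ shift Q₁ n + shift W n + conv A′ W n
      W-unfold = begin
        W n
          ≡⟨ conv-comm Q₁ A″ n ⟩
        conv A″ Q₁ n
          ≡⟨ conv-cong (A-rec k) (λ _ → refl) n ⟩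
        conv (shift 𝟙 ⊕ shift A″ ⊕ conv A′ A″) Q₁ n
          ≡⟨ conv-distribʳ-⊕ (shift 𝟙 ⊕ shift A″) (conv A′ A″) Q₁ n ⟩
        conv (shift 𝟙 ⊕ shift A″) Q₁ n + conv (conv A′ A″) Q₁ n
          ≡⟨ cong₂ _+_ (conv-distribʳ-⊕ (shift 𝟙) (shift A″) Q₁ n) (conv-assoc A′ A″ Q₁ n) ⟩
        conv (shift 𝟙) Q₁ n + conv (shift A″) Q₁ n + conv A′ (conv A″ Q₁) n
          ≡⟨ cong₂ _+_ (cong₂ _+_ (trans (conv-shiftˡ 𝟙 Q₁ n) (shift-cong (conv-identityˡ Q₁) n))
                                 (trans (conv-shiftˡ A″ Q₁ n) (shift-cong (conv-comm A″ Q₁) n)))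
                       (conv-cong (λ _ → refl) (conv-comm A″ Q₁) n) ⟩
        shift Q₁ n + shift W n + conv A′ W n ∎

  module _ (c : ℕ → ℕ → ℕ) (c-zero : ∀ k → c (suc k) 0 ≡ 1) (c-one : ∀ n → c 1 (suc n) ≡ 0)
    (c-suc : ∀ k n → c (suc (suc k)) (suc n) ≡
                     c (suc (suc k)) n ℕ.+
                     sum (map (λ i → c (suc k) i ℕ.* c (suc (suc k)) (suc n ℕ.∸ i)) (map suc (downFrom n))))
    where

    A : ℕ → Series
    A k = minusOne (gf (c k))

    A-zero : ∀ k → A (suc k) 0 ≡ + 0
    A-zero k rewrite c-zero k = refl

    products : ℕ → ℕ → ℕ → ℕ
    products k n j = sum (map (λ i → c (suc k) i ℕ.* c (suc (suc k)) (suc n ℕ.∸ i)) (map suc (downFrom j)))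

    convAux-products : ∀ k n j → j ≤ n → convAux (A (suc k)) (A (suc (suc k))) (suc n) j ≡ + products k n j
    convAux-products k n zero    _   rewrite A-zero k = refl
    convAux-products k n (suc j) j<n rewrite convAux-products k n j (ℕ.<⇒≤ j<n) | ℕ.+-∸-assoc 1 j<n =
      trans (cong (_+ + products k n j) (sym (ℤ.pos-* (c (suc k) (suc j)) (c (suc (suc k)) (suc (n ℕ.∸ suc j))))))
            (sym (ℤ.pos-+ _ (products k n j)))

    A-one : A 1 ≈ 𝟘
    A-one zero    rewrite c-zero 0 = refl
    A-one (suc n) rewrite c-one n  = refl

    A-rec : ∀ k → A (suc (suc k)) ≈ shift 𝟙 ⊕ shift (A (suc (suc k))) ⊕ conv (A (suc k)) (A (suc (suc k)))
    A-rec k zero    rewrite A-zero (suc k) | A-zero k = refl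
    A-rec k (suc n) = sym (begin
      𝟙 n + A (suc (suc k)) n + conv (A (suc k)) (A (suc (suc k))) (suc n)
        ≡⟨ cong₂ _+_ (lower-terms n) conv-terms ⟩
      + c (suc (suc k)) n + + products k n n
        ≡⟨ sym (ℤ.pos-+ (c (suc (suc k)) n) (products k n n)) ⟩
      + (c (suc (suc k)) n ℕ.+ products k n n)
        ≡⟨ cong +_ (sym (c-suc k n)) ⟩
      + c (suc (suc k)) (suc n) ∎)
      where
      open ≡-Reasoning
      lower-terms : ∀ m → 𝟙 m + A (suc (suc k)) m ≡ + c (suc (suc k)) m
      lower-terms zero    rewrite c-zero (suc k) = refl
      lower-terms (suc m) = ℤ.+-identityˡ _
      conv-terms : conv (A (suc k)) (A (suc (suc k))) (suc n) ≡ + products k n n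
      conv-terms rewrite ℕ.n∸n≡0 n | A-zero (suc k) | ℤ.*-zeroʳ (A (suc k) (suc n)) =
        trans (ℤ.+-identityˡ _) (convAux-products k n n ℕ.≤-refl)

    gf-conv-chebQ : ∀ k → 1 ≤ k → ∀ n → conv (A k) (chebQ k) n ≡ shift (chebQ (k ℕ.∸ 1)) n
    gf-conv-chebQ (suc k) _ = conv-chebQ A A-one A-rec k

open PowerSeries using (gf-conv-chebQ)

open import Data.Bool using (Bool; true; false; T; not; _∧_)
open import Data.Bool.Properties using (T-∧)
open import Data.Empty using (⊥; ⊥-elim)
open import Data.Nat using (zero; suc; _+_; _*_; _<_; _<ᵇ_; _≡ᵇ_; z≤n; s≤s; z<s; s<s; _≟_; _≤?_; _<?_)
open import Data.Nat.ListAction using (sum)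
open import Data.Nat.Properties
open import Data.List
  using (_++_; _∷ʳ_; map; length; upTo; downFrom; applyUpTo; filter; filterᵇ; concatMap;
         cartesianProduct; cartesianProductWith; initLast; _∷ʳ′_)
open import Data.List.Properties
  using (length-map; length-++; length-filter; filter-notAll; length-applyUpTo; length-upTo; map-cong; map-++;
         applyUpTo-∷ʳ; ++-assoc; ++-identityʳ; ∷-injective; ∷ʳ-injective)
open import Data.List.Extrema.Nat using (min; min≤⊤; min≤xs; min≤v⁺; v≤min⁺; argmin-sel)
open import Data.List.Membership.Propositional using (_∈_; _∉_; find; lose)
open import Data.List.Membership.Propositional.Properties
  using (∈-map⁺; ∈-map⁻; ∈-++⁺ˡ; ∈-++⁺ʳ; ∈-++⁻; ∈-∃++; ∈-concatMap⁺; ∈-concatMap⁻; ∈-filter⁺; ∈-filter⁻;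
         ∈-applyUpTo⁺; ∈-applyUpTo⁻; ∈-upTo⁺; ∈-upTo⁻; ∈-downFrom⁺; ∈-downFrom⁻; ∈-cartesianProduct⁺;
         ∈-cartesianProduct⁻; ∈-cartesianProductWith⁺; ∈-cartesianProductWith⁻; ∈-length)
open import Data.List.Membership.Propositional.Properties.WithK using (unique∧set⇒bag)
open import Data.List.Membership.DecPropositional _≟_ using (_∈?_)
open import Data.List.Relation.Unary.All using (All; []; _∷_)
import Data.List.Relation.Unary.All as All
import Data.List.Relation.Unary.All.Properties as All
open import Data.List.Relation.Unary.Any using (Any; here; there)
import Data.List.Relation.Unary.Any.Properties as Any
open import Data.List.Relation.Unary.AllPairs using (AllPairs; []; _∷_)
import Data.List.Relation.Unary.AllPairs.Properties as AllPairs
open import Data.List.Relation.Unary.Unique.Propositional using (Unique)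
import Data.List.Relation.Unary.Unique.Propositional.Properties as Unique
open import Data.List.Relation.Binary.Sublist.Propositional
  using (_⊆_; []; _∷_; ⊆-refl; ⊆-trans; minimum; from∈; lookup) renaming (_∷ʳ_ to skip)
import Data.List.Relation.Binary.Sublist.Propositional.Properties as Sublist
open import Data.List.Relation.Binary.BagAndSetEquality using (∼bag⇒↭)
open import Data.List.Relation.Binary.Permutation.Propositional.Properties using (↭-length)
open import Data.List.Relation.Binary.Disjoint.Propositional using (Disjoint)
open import Data.Product using (∃; ∃₂; _,_; proj₁; proj₂; map₁)
open import Data.Sum using (_⊎_; inj₁; inj₂; [_,_]′)
open import Data.Sum.Properties using (inj₁-injective; inj₂-injective)
open import Function using (_∘_; _⇔_; mk⇔; Equivalence)
open import Function.Construct.Composition using (_⇔-∘_)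
open import Function.Construct.Symmetry using (⇔-sym)
open import Relation.Binary.PropositionalEquality using (refl; sym; trans; cong; cong₂; subst; _≢_; module ≡-Reasoning)
open import Relation.Binary.Definitions using (tri<; tri≈; tri>)
open import Relation.Nullary using (¬_; yes; no; ofʸ; ofⁿ)
open import Relation.Nullary.Decidable using (T?)

open Equivalence using (to; from)

private variable
  A B : Set

-- Lists and sublists

-- The append in the definition of subseqs is local; unification recovers it.
mutual
  appendₛ : {A : Set} → A → List A → List (List A) → List (List A) → List (List A)
  appendₛ = _

  subseqs-unfold : {A : Set} (a : A) (as : List A) →
                   subseqs (a ∷ as) ≡ appendₛ a as (map (a ∷_) (subseqs as)) (subseqs as)
  subseqs-unfold {A} a as with subseqs as
  ... | ys with map {B = List A} (a ∷_) ys
  ... | xs = refl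

appendₛ≡++ : (a : A) (as : List A) (xs ys : List (List A)) → appendₛ a as xs ys ≡ xs ++ ys
appendₛ≡++ a as []       ys = refl
appendₛ≡++ a as (x ∷ xs) ys = cong (x ∷_) (appendₛ≡++ a as xs ys)

subseqs-∷ : (a : A) (as : List A) → subseqs (a ∷ as) ≡ map (a ∷_) (subseqs as) ++ subseqs as
subseqs-∷ a as = trans (subseqs-unfold a as) (appendₛ≡++ a as (map (a ∷_) (subseqs as)) (subseqs as))

∈-subseqs⁺ : {s xs : List A} → s ⊆ xs → s ∈ subseqs xs
∈-subseqs⁺ []                         = here refl
∈-subseqs⁺ {xs = x ∷ xs} (skip .x τ) rewrite subseqs-∷ x xs = ∈-++⁺ʳ _ (∈-subseqs⁺ τ)
∈-subseqs⁺ {xs = x ∷ xs} (refl ∷ τ)  rewrite subseqs-∷ x xs = ∈-++⁺ˡ (∈-map⁺ (x ∷_) (∈-subseqs⁺ τ))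

∈-subseqs⁻ : (xs : List A) {s : List A} → s ∈ subseqs xs → s ⊆ xs
∈-subseqs⁻ []       (here refl) = []
∈-subseqs⁻ (x ∷ xs) p rewrite subseqs-∷ x xs with ∈-++⁻ (map (x ∷_) (subseqs xs)) p
... | inj₁ q with s , s∈ , refl ← ∈-map⁻ (x ∷_) q = refl ∷ ∈-subseqs⁻ xs s∈
... | inj₂ q = skip x (∈-subseqs⁻ xs q)

∈-subseqs : {s xs : List A} → s ∈ subseqs xs ⇔ s ⊆ xs
∈-subseqs = mk⇔ (∈-subseqs⁻ _) ∈-subseqs⁺

⊆-++⁻ : (xs ys : List A) {s : List A} → s ⊆ xs ++ ys →
        ∃₂ λ s₁ s₂ → s ≡ s₁ ++ s₂ × s₁ ⊆ xs × s₂ ⊆ ys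
⊆-++⁻ []       ys τ           = [] , _ , refl , [] , τ
⊆-++⁻ (x ∷ xs) ys (skip .x τ) with s₁ , s₂ , refl , τ₁ , τ₂ ← ⊆-++⁻ xs ys τ =
  s₁ , s₂ , refl , skip x τ₁ , τ₂
⊆-++⁻ (x ∷ xs) ys (refl ∷ τ)  with s₁ , s₂ , refl , τ₁ , τ₂ ← ⊆-++⁻ xs ys τ =
  x ∷ s₁ , s₂ , refl , refl ∷ τ₁ , τ₂

⊆-map⁻ : (f : A → B) (xs : List A) {s : List B} → s ⊆ map f xs → ∃ λ s′ → s ≡ map f s′ × s′ ⊆ xs
⊆-map⁻ f []       []          = [] , refl , []
⊆-map⁻ f (x ∷ xs) (skip ._ τ) with s′ , refl , τ′ ← ⊆-map⁻ f xs τ = s′ , refl , skip x τ′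
⊆-map⁻ f (x ∷ xs) (refl ∷ τ) with s′ , refl , τ′ ← ⊆-map⁻ f xs τ = x ∷ s′ , refl , refl ∷ τ′

All-resp-⊆ : {P : A → Set} {s xs : List A} → s ⊆ xs → All P xs → All P s
All-resp-⊆ []         []         = []
All-resp-⊆ (skip _ τ) (_ ∷ pxs)  = All-resp-⊆ τ pxs
All-resp-⊆ (refl ∷ τ) (px ∷ pxs) = px ∷ All-resp-⊆ τ pxs

AllPairs-resp-⊆ : {R : A → A → Set} {s xs : List A} → s ⊆ xs → AllPairs R xs → AllPairs R s
AllPairs-resp-⊆ []         []       = []
AllPairs-resp-⊆ (skip _ τ) (_ ∷ rs) = AllPairs-resp-⊆ τ rs
AllPairs-resp-⊆ (refl ∷ τ) (r ∷ rs) = All-resp-⊆ τ r ∷ AllPairs-resp-⊆ τ rs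

AllPairs-∷ʳ⁻ : {R : A → A → Set} {xs : List A} {x : A} →
               AllPairs R (xs ∷ʳ x) → AllPairs R xs × All (λ y → R y x) xs
AllPairs-∷ʳ⁻ {xs = []}     _        = [] , []
AllPairs-∷ʳ⁻ {xs = y ∷ xs} (r ∷ rs) with rxs , rx ← AllPairs-∷ʳ⁻ rs | rys , ryx ← All.∷ʳ⁻ r =
  rys ∷ rxs , ryx ∷ rx

AllPairs-∷ʳ⁺ : {R : A → A → Set} {xs : List A} {x : A} →
               AllPairs R xs → All (λ y → R y x) xs → AllPairs R (xs ∷ʳ x)
AllPairs-∷ʳ⁺ []       []         = [] ∷ []
AllPairs-∷ʳ⁺ (r ∷ rs) (ryx ∷ rx) = All.∷ʳ⁺ r ryx ∷ AllPairs-∷ʳ⁺ rs rx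

∷ʳ-prefix-⊆ : {t : List A} {x : A} {l : List A} → (t ∷ʳ x) ⊆ l → t ⊆ l
∷ʳ-prefix-⊆ {x = x} τ = ⊆-trans (Sublist.++⁺ʳ (x ∷ []) ⊆-refl) τ

Unique-All≡⇒⊆[_] : ∀ (x : A) {s : List A} → Unique s → All (_≡ x) s → s ⊆ x ∷ []
Unique-All≡⇒⊆[ x ] []              []                = skip x []
Unique-All≡⇒⊆[ x ] (_ ∷ [])        (refl ∷ [])       = ⊆-refl
Unique-All≡⇒⊆[ x ] ((x≢x ∷ _) ∷ _) (refl ∷ refl ∷ _) = ⊥-elim (x≢x refl)

∈-pair-⊆ : ∀ {x y : A} {xs} → x ∈ xs → y ∈ xs → x ≢ y → (x ∷ y ∷ []) ⊆ xs ⊎ (y ∷ x ∷ []) ⊆ xs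
∈-pair-⊆ (here refl) (here refl) x≢y = ⊥-elim (x≢y refl)
∈-pair-⊆ (here refl) (there y∈) _   = inj₁ (refl ∷ from∈ y∈)
∈-pair-⊆ (there x∈) (here refl) _   = inj₂ (refl ∷ from∈ x∈)
∈-pair-⊆ {xs = z ∷ _} (there x∈) (there y∈) x≢y with ∈-pair-⊆ x∈ y∈ x≢y
... | inj₁ τ = inj₁ (skip z τ)
... | inj₂ τ = inj₂ (skip z τ)

Unique-++-disjoint : ∀ (xs : List A) {ys} → Unique (xs ++ ys) → ∀ {x y} → x ∈ xs → y ∈ ys → x ≢ y
Unique-++-disjoint (z ∷ xs) (z∉ ∷ _) (here refl) y∈ = All.lookup z∉ (∈-++⁺ʳ xs y∈)
Unique-++-disjoint (z ∷ xs) (_ ∷ u)  (there x∈) y∈  = Unique-++-disjoint xs u x∈ y∈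

∄∈⇒≡[] : {xs : List A} → (∀ {x} → x ∉ xs) → xs ≡ []
∄∈⇒≡[] {xs = []}    _   = refl
∄∈⇒≡[] {xs = x ∷ _} x∉ = ⊥-elim (x∉ (here refl))

∈-∷ʳ : (t : List A) {x : A} → x ∈ t ∷ʳ x
∈-∷ʳ t = ∈-++⁺ʳ t (here refl)

length-∷ʳ : (xs : List A) {x : A} → length (xs ∷ʳ x) ≡ suc (length xs)
length-∷ʳ xs = trans (length-++ xs) (+-comm (length xs) 1)

map-leftInverse : (f : A → B) (g : B → A) {xs : List A} →
                  (∀ {x} → x ∈ xs → g (f x) ≡ x) → map g (map f xs) ≡ xs
map-leftInverse f g {[]}     gf = refl
map-leftInverse f g {x ∷ xs} gf = cong₂ _∷_ (gf (here refl)) (map-leftInverse f g (gf ∘ there))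

Unique-map-leftInverse : (f : A → B) (g : B → A) {xs : List A} →
                         (∀ {x} → x ∈ xs → g (f x) ≡ x) → Unique xs → Unique (map f xs)
Unique-map-leftInverse f g inverse uxs = Unique.map⁻ (subst Unique (sym (map-leftInverse f g inverse)) uxs)

Unique-concatMap⁺ : {xs : List A} (f : A → List B) (key : B → A) →
  Unique xs → (∀ {x} → x ∈ xs → Unique (f x)) → (∀ {x y} → x ∈ xs → y ∈ f x → key y ≡ x) →
  Unique (concatMap f xs)
Unique-concatMap⁺ {xs = []}     f key []         uf kf = []
Unique-concatMap⁺ {xs = x ∷ xs} f key (x∉ ∷ uxs) uf kf =
  Unique.++⁺ (uf (here refl)) (Unique-concatMap⁺ f key uxs (uf ∘ there) (kf ∘ there)) disjoint
  where
  disjoint : Disjoint (f x) (concatMap f xs)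
  disjoint (y∈fx , y∈rest) with x′ , x′∈ , y∈fx′ ← find (∈-concatMap⁻ f y∈rest) =
    All.lookup x∉ x′∈ (trans (sym (kf (here refl) y∈fx)) (kf (there x′∈) y∈fx′))

length-concatMap : (f : A → List B) (xs : List A) → length (concatMap f xs) ≡ sum (map (length ∘ f) xs)
length-concatMap f []       = refl
length-concatMap f (x ∷ xs) = trans (length-++ (f x)) (cong (length (f x) +_) (length-concatMap f xs))

length-cartesianProduct : (xs : List A) (ys : List B) → length (cartesianProduct xs ys) ≡ length xs * length ys
length-cartesianProduct []       ys = refl
length-cartesianProduct (x ∷ xs) ys = begin
  length (map (x ,_) ys ++ cartesianProduct xs ys)
    ≡⟨ length-++ (map (x ,_) ys) ⟩
  length (map (x ,_) ys) + length (cartesianProduct xs ys)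
    ≡⟨ cong₂ _+_ (length-map (x ,_) ys) (length-cartesianProduct xs ys) ⟩
  length ys + length xs * length ys ∎
  where open ≡-Reasoning

-- map f xs and ys are duplicate-free lists with the same members, hence permutations of each other.
length-≡-bijection : {xs : List A} {ys : List B} (f : A → B) (g : B → A) →
  Unique xs → Unique ys →
  (∀ {x} → x ∈ xs → f x ∈ ys) →
  (∀ {y} → y ∈ ys → ∃ λ x → x ∈ xs × f x ≡ y) →
  (∀ {x} → x ∈ xs → g (f x) ≡ x) →
  length xs ≡ length ys
length-≡-bijection {xs = xs} {ys} f g uxs uys into onto inverse =
  trans (sym (length-map f xs))
        (↭-length (∼bag⇒↭ (unique∧set⇒bag (Unique-map-leftInverse f g inverse uxs) uys (mk⇔ image⊆ys ys⊆image))))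
  where
  image⊆ys : ∀ {y} → y ∈ map f xs → y ∈ ys
  image⊆ys p with x , x∈ , refl ← ∈-map⁻ f p = into x∈
  ys⊆image : ∀ {y} → y ∈ ys → y ∈ map f xs
  ys⊆image p with x , x∈ , refl ← onto p = ∈-map⁺ f x∈

module _ {xs ys : List ℕ} (uxs : Unique xs) (uys : Unique ys) (xs⊆ys : ∀ {x} → x ∈ xs → x ∈ ys) where

  private
    common : List ℕ
    common = filter (_∈? xs) ys

    length-common : length common ≡ length xs
    length-common =
      ↭-length (∼bag⇒↭ (unique∧set⇒bag (Unique.filter⁺ (_∈? xs) {ys} uys) uxs (mk⇔ common⊆xs xs⊆common)))
      where
      common⊆xs : ∀ {z} → z ∈ common → z ∈ xs
      common⊆xs z∈ = proj₂ (∈-filter⁻ (_∈? xs) {xs = ys} z∈)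
      xs⊆common : ∀ {z} → z ∈ xs → z ∈ common
      xs⊆common z∈ = ∈-filter⁺ (_∈? xs) (xs⊆ys z∈) z∈

  Unique-length-≤ : length xs ≤ length ys
  Unique-length-≤ = subst (_≤ length ys) length-common (length-filter (_∈? xs) ys)

  Unique-length-≥⇒⊇ : length ys ≤ length xs → ∀ {y} → y ∈ ys → y ∈ xs
  Unique-length-≥⇒⊇ ys≤xs {y} y∈ with y ∈? xs
  ... | yes y∈xs = y∈xs
  ... | no  y∉xs =
    ⊥-elim (<⇒≱ (subst (_< length ys) length-common (filter-notAll (_∈? xs) ys (lose y∈ y∉xs))) ys≤xs)

interval : ℕ → ℕ → List ℕ
interval lo k = applyUpTo (lo +_) k

Unique-interval : ∀ lo k → Unique (interval lo k)
Unique-interval lo k = Unique.applyUpTo⁺₁ (lo +_) k (λ i<j _ → <⇒≢ (+-monoʳ-< lo i<j))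

∈-interval⁺ : ∀ {lo k z} → lo ≤ z → z < lo + k → z ∈ interval lo k
∈-interval⁺ {lo} {k} {z} lo≤z z<lo+k =
  subst (_∈ interval lo k) (m+[n∸m]≡n lo≤z)
    (∈-applyUpTo⁺ (lo +_) (subst (z ∸ lo <_) (m+n∸m≡n lo k) (∸-monoˡ-< z<lo+k lo≤z)))

∈-interval⁻ : ∀ {lo k z} → z ∈ interval lo k → lo ≤ z × z < lo + k
∈-interval⁻ {lo} z∈ with i , i<k , refl ← ∈-applyUpTo⁻ (lo +_) z∈ = m≤m+n lo i , +-monoʳ-< lo i<k

length-≤-interval : ∀ {lo hi} {xs : List ℕ} → lo ≤ hi → Unique xs → All (λ z → lo ≤ z × z < hi) xs →
                    length xs + lo ≤ hi
length-≤-interval {lo} {hi} {xs} lo≤hi uxs bounds =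
  subst (length xs + lo ≤_) (m∸n+n≡m lo≤hi) (+-monoˡ-≤ lo length≤)
  where
  xs⊆ : ∀ {z} → z ∈ xs → z ∈ interval lo (hi ∸ lo)
  xs⊆ z∈ with lo≤z , z<hi ← All.lookup bounds z∈ =
    ∈-interval⁺ lo≤z (subst (_ <_) (sym (m+[n∸m]≡n lo≤hi)) z<hi)
  length≤ : length xs ≤ hi ∸ lo
  length≤ = subst (_ ≤_) (length-applyUpTo (lo +_) (hi ∸ lo))
                  (Unique-length-≤ uxs (Unique-interval lo (hi ∸ lo)) xs⊆)

-- Pattern containment

Concordant : ℕ × ℕ → ℕ × ℕ → Set
Concordant (a , b) (c , d) = a < c ⇔ b < d

OrderIso : List ℕ → List ℕ → Set
OrderIso s σ = length s ≡ length σ × AllPairs Concordant (zipL s σ)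

Contains : List ℕ → List ℕ → Set
Contains π σ = ∃ λ s → s ⊆ π × OrderIso s σ

sameLength⇔ : ∀ s t → T (sameLength s t) ⇔ length s ≡ length t
sameLength⇔ []      []      = mk⇔ (λ _ → refl) _
sameLength⇔ []      (_ ∷ _) = mk⇔ (λ ()) (λ ())
sameLength⇔ (_ ∷ _) []      = mk⇔ (λ ()) (λ ())
sameLength⇔ (_ ∷ s) (_ ∷ t) = mk⇔ (cong suc ∘ to (sameLength⇔ s t)) (from (sameLength⇔ s t) ∘ suc-injective)

both : {P Q : Set} → P → Q → P ⇔ Q
both p q = mk⇔ (λ _ → q) (λ _ → p)

neither : {P Q : Set} → ¬ P → ¬ Q → P ⇔ Q
neither ¬p ¬q = mk⇔ (⊥-elim ∘ ¬p) (⊥-elim ∘ ¬q)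

concordant⇔ : ∀ a b c d → T ((a <ᵇ c) ==ᵇ (b <ᵇ d)) ⇔ Concordant (a , b) (c , d)
concordant⇔ a b c d with a <ᵇ c | <ᵇ-reflects-< a c | b <ᵇ d | <ᵇ-reflects-< b d
... | true  | ofʸ a<c | true  | ofʸ b<d = mk⇔ (λ _ → both a<c b<d) _
... | true  | ofʸ a<c | false | ofⁿ b≮d = mk⇔ (λ ()) (λ a<c⇔b<d → b≮d (to a<c⇔b<d a<c))
... | false | ofⁿ a≮c | true  | ofʸ b<d = mk⇔ (λ ()) (λ a<c⇔b<d → a≮c (from a<c⇔b<d b<d))
... | false | ofⁿ a≮c | false | ofⁿ b≮d = mk⇔ (λ _ → neither a≮c b≮d) _

pairsOK⇔ : ∀ ps → T (pairsOK ps) ⇔ AllPairs Concordant ps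
pairsOK⇔ []             = mk⇔ (λ _ → []) _
pairsOK⇔ ((a , b) ∷ ps) = mk⇔
  (λ t → let t₁ , t₂ = to T-∧ t in
         All.map (λ {(c , d)} → to (concordant⇔ a b c d)) (All.all⁺ _ ps t₁) ∷ to (pairsOK⇔ ps) t₂)
  (λ { (c ∷ cs) → from T-∧ ( All.all⁻ _ (All.map (λ {(c , d)} → from (concordant⇔ a b c d)) c)
                            , from (pairsOK⇔ ps) cs) })

orderIso⇔ : ∀ s σ → T (orderIso s σ) ⇔ OrderIso s σ
orderIso⇔ s σ = mk⇔
  (λ t → let t₁ , t₂ = to T-∧ t in to (sameLength⇔ s σ) t₁ , to (pairsOK⇔ (zipL s σ)) t₂)
  (λ (l , c) → from T-∧ (from (sameLength⇔ s σ) l , from (pairsOK⇔ (zipL s σ)) c))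

contains⇔ : ∀ π σ → T (contains π σ) ⇔ Contains π σ
contains⇔ π σ = mk⇔
  (λ t → let s , s∈ , o = find (Any.any⁻ _ (subseqs π) t) in s , to ∈-subseqs s∈ , to (orderIso⇔ s σ) o)
  (λ (s , τ , o) → Any.any⁺ _ (lose (from ∈-subseqs τ) (from (orderIso⇔ s σ) o)))

zipL-++ : ∀ {s₁ σ₁} s₂ σ₂ → length s₁ ≡ length σ₁ → zipL (s₁ ++ s₂) (σ₁ ++ σ₂) ≡ zipL s₁ σ₁ ++ zipL s₂ σ₂
zipL-++ {[]}     {[]}     s₂ σ₂ _ = refl
zipL-++ {a ∷ s₁} {b ∷ σ₁} s₂ σ₂ l = cong ((a , b) ∷_) (zipL-++ s₂ σ₂ (suc-injective l))

concordant-∷ʳ : ∀ {x y} s σ → length s ≡ length σ → All (_< y) σ →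
                All (λ p → Concordant p (x , y)) (zipL s σ) ⇔ All (_< x) s
concordant-∷ʳ []      []      _ _          = mk⇔ (λ _ → []) (λ _ → [])
concordant-∷ʳ (a ∷ s) (b ∷ σ) l (b<y ∷ σ<y) = mk⇔
  (λ { (c ∷ cs) → from c b<y ∷ to (concordant-∷ʳ s σ (suc-injective l) σ<y) cs })
  (λ { (a<x ∷ s<x) → both a<x b<y ∷ from (concordant-∷ʳ s σ (suc-injective l) σ<y) s<x })

OrderIso-∷ʳ⁻ : ∀ {x y} s σ → All (_< y) σ → OrderIso (s ∷ʳ x) (σ ∷ʳ y) → OrderIso s σ × All (_< x) s
OrderIso-∷ʳ⁻ {x} {y} s σ σ<y (l , c) =
  let l′ = suc-injective (trans (sym (length-∷ʳ s)) (trans l (length-∷ʳ σ)))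
      c₁ , c₂ = AllPairs-∷ʳ⁻ (subst (AllPairs Concordant) (zipL-++ (x ∷ []) (y ∷ []) l′) c)
  in (l′ , c₁) , to (concordant-∷ʳ s σ l′ σ<y) c₂

OrderIso-∷ʳ⁺ : ∀ {x y} s σ → All (_< y) σ → OrderIso s σ → All (_< x) s → OrderIso (s ∷ʳ x) (σ ∷ʳ y)
OrderIso-∷ʳ⁺ {x} {y} s σ σ<y (l , c) s<x =
  trans (length-∷ʳ s) (trans (cong suc l) (sym (length-∷ʳ σ))) ,
  subst (AllPairs Concordant) (sym (zipL-++ (x ∷ []) (y ∷ []) l))
    (AllPairs-∷ʳ⁺ c (from (concordant-∷ʳ s σ l σ<y) s<x))

StrictlyIncreasingOn : (ℕ → ℕ) → List ℕ → Set
StrictlyIncreasingOn f xs = ∀ {u v} → u ∈ xs → v ∈ xs → u < v → f u < f v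

StrictlyIncreasingOn-⊆ : ∀ {f s xs} → s ⊆ xs → StrictlyIncreasingOn f xs → StrictlyIncreasingOn f s
StrictlyIncreasingOn-⊆ τ inc u∈ v∈ = inc (lookup τ u∈) (lookup τ v∈)

strictlyIncreasing⇔ : ∀ {f xs u v} → StrictlyIncreasingOn f xs → u ∈ xs → v ∈ xs → f u < f v ⇔ u < v
strictlyIncreasing⇔ {f} {u = u} {v} inc u∈ v∈ = mk⇔ reflect (inc u∈ v∈)
  where
  reflect : f u < f v → u < v
  reflect fu<fv with <-cmp u v
  ... | tri< u<v _ _  = u<v
  ... | tri≈ _ refl _ = ⊥-elim (<-irrefl refl fu<fv)
  ... | tri> _ _ v<u  = ⊥-elim (<-asym fu<fv (inc v∈ u∈ v<u))

OrderIso-map⁻ : ∀ f s {σ} → StrictlyIncreasingOn f s → OrderIso (map f s) σ → OrderIso s σ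
OrderIso-map⁻ f s {σ} inc (l , c) =
  trans (sym (length-map f s)) l , relabel s σ (strictlyIncreasing⇔ inc) c
  where
  OrderPreservingOn : List ℕ → Set
  OrderPreservingOn t = ∀ {u v} → u ∈ t → v ∈ t → f u < f v ⇔ u < v

  relabel : ∀ t τ → OrderPreservingOn t → AllPairs Concordant (zipL (map f t) τ) → AllPairs Concordant (zipL t τ)
  relabel []      τ       _    _        = []
  relabel (u ∷ t) []      _    _        = []
  relabel (u ∷ t) (b ∷ τ) pres (c ∷ cs) =
    first t τ (pres (here refl) ∘ there) c ∷ relabel t τ (λ p q → pres (there p) (there q)) cs
    where
    first : ∀ t τ → (∀ {v} → v ∈ t → f u < f v ⇔ u < v) →
            All (Concordant (f u , b)) (zipL (map f t) τ) → All (Concordant (u , b)) (zipL t τ)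
    first []      τ       _ _        = []
    first (v ∷ t) []      _ _        = []
    first (v ∷ t) (d ∷ τ) m (c ∷ cs) = c ⇔-∘ ⇔-sym (m (here refl)) ∷ first t τ (m ∘ there) cs

Contains-map⁻ : ∀ {f π σ} → StrictlyIncreasingOn f π → Contains (map f π) σ → Contains π σ
Contains-map⁻ {f} {π} inc (s , τ , o) with s′ , refl , τ′ ← ⊆-map⁻ f π τ =
  s′ , τ′ , OrderIso-map⁻ f s′ (StrictlyIncreasingOn-⊆ τ′ inc) o

-- Entries a, b, c, d in this order with a, b < d ≤ c: an occurrence of 1243 (a < b) or of 2143 (b ≤ a).
Contains1243∨2143 : List ℕ → Set
Contains1243∨2143 π = ∃ λ a → ∃ λ b → ∃ λ c → ∃ λ d → (a ∷ b ∷ c ∷ d ∷ []) ⊆ π × a < d × b < d × d ≤ c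

contains1243∨2143⇔ : ∀ π → (Contains π p1243 ⊎ Contains π p2143) ⇔ Contains1243∨2143 π
contains1243∨2143⇔ π = mk⇔ decode encode
  where
  ¬4<3 : ¬ 4 < 3
  ¬4<3 = ≤⇒≯ (n≤1+n 3)

  decode : Contains π p1243 ⊎ Contains π p2143 → Contains1243∨2143 π
  decode (inj₁ (a ∷ b ∷ c ∷ d ∷ [] , τ , _ , (_ ∷ _ ∷ ad ∷ []) ∷ (_ ∷ bd ∷ []) ∷ (cd ∷ []) ∷ _)) =
    a , b , c , d , τ , from ad (s<s z<s) , from bd (s<s (s<s z<s)) , ≮⇒≥ (¬4<3 ∘ to cd)
  decode (inj₂ (a ∷ b ∷ c ∷ d ∷ [] , τ , _ , (_ ∷ _ ∷ ad ∷ []) ∷ (_ ∷ bd ∷ []) ∷ (cd ∷ []) ∷ _)) =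
    a , b , c , d , τ , from ad (s<s (s<s z<s)) , from bd (s<s z<s) , ≮⇒≥ (¬4<3 ∘ to cd)
  decode (inj₁ (_ ∷ _ ∷ _ ∷ _ ∷ _ ∷ _ , _ , () , _))
  decode (inj₂ (_ ∷ _ ∷ _ ∷ _ ∷ _ ∷ _ , _ , () , _))

  c≮d : ∀ {c d} → d ≤ c → c < d ⇔ 4 < 3
  c≮d d≤c = neither (≤⇒≯ d≤c) ¬4<3

  encode : Contains1243∨2143 π → Contains π p1243 ⊎ Contains π p2143
  encode (a , b , c , d , τ , a<d , b<d , d≤c) with a <? b
  ... | yes a<b = inj₁ (_ , τ , refl ,
    (both a<b (s<s z<s) ∷ both (<-≤-trans a<d d≤c) (s<s z<s) ∷ both a<d (s<s z<s) ∷ []) ∷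
    (both (<-≤-trans b<d d≤c) (s<s (s<s z<s)) ∷ both b<d (s<s (s<s z<s)) ∷ []) ∷
    (c≮d d≤c ∷ []) ∷ [] ∷ [])
  ... | no a≮b  = inj₂ (_ , τ , refl ,
    (neither a≮b (≤⇒≯ (n≤1+n 1)) ∷ both (<-≤-trans a<d d≤c) (s<s (s<s z<s)) ∷
     both a<d (s<s (s<s z<s)) ∷ []) ∷
    (both (<-≤-trans b<d d≤c) (s<s z<s) ∷ both b<d (s<s z<s) ∷ []) ∷
    (c≮d d≤c ∷ []) ∷ [] ∷ [])

Avoids : List ℕ → List ℕ → Set
Avoids σ π = ¬ Contains1243∨2143 π × ¬ Contains π σ

T-not : ∀ b → T (not b) ⇔ (¬ T b)
T-not true  = mk⇔ (λ ()) (λ ¬t → ¬t _)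
T-not false = mk⇔ (λ _ ()) _

avoidsAll⇔ : ∀ σ π → T (avoidsAll (p1243 ∷ p2143 ∷ σ ∷ []) π) ⇔ Avoids σ π
avoidsAll⇔ σ π = mk⇔ to′ from′
  where
  c₁ c₂ c₃ : Bool
  c₁ = contains π p1243
  c₂ = contains π p2143
  c₃ = contains π σ

  to′ : T (not c₁ ∧ (not c₂ ∧ (not c₃ ∧ true))) → Avoids σ π
  to′ t =
    let t₁ , t₂₃ = to T-∧ t
        t₂ , t₃₊ = to T-∧ t₂₃
        t₃ , _   = to T-∧ t₃₊
    in [ to (T-not c₁) t₁ ∘ from (contains⇔ π p1243) , to (T-not c₂) t₂ ∘ from (contains⇔ π p2143) ]′
         ∘ from (contains1243∨2143⇔ π)
     , to (T-not c₃) t₃ ∘ from (contains⇔ π σ)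

  from′ : Avoids σ π → T (not c₁ ∧ (not c₂ ∧ (not c₃ ∧ true)))
  from′ (¬c , ¬cσ) =
    from T-∧ ( from (T-not c₁) (¬c ∘ to (contains1243∨2143⇔ π) ∘ inj₁ ∘ to (contains⇔ π p1243))
             , from T-∧ ( from (T-not c₂) (¬c ∘ to (contains1243∨2143⇔ π) ∘ inj₂ ∘ to (contains⇔ π p2143))
                        , from T-∧ (from (T-not c₃) (¬cσ ∘ to (contains⇔ π σ)) , _)))

Contains1243∨2143-map⁻ : ∀ {f π} → StrictlyIncreasingOn f π → Contains1243∨2143 (map f π) → Contains1243∨2143 π
Contains1243∨2143-map⁻ {f} {π} inc (_ , _ , _ , _ , τ , fa<fd , fb<fd , fd≤fc)
  with a ∷ b ∷ c ∷ d ∷ [] , refl , τ′ ← ⊆-map⁻ f π τ =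
  a , b , c , d , τ′ , to (reflect a∈ d∈) fa<fd , to (reflect b∈ d∈) fb<fd ,
  ≮⇒≥ (≤⇒≯ fd≤fc ∘ from (reflect c∈ d∈))
  where
  reflect : ∀ {u v} → u ∈ π → v ∈ π → f u < f v ⇔ u < v
  reflect = strictlyIncreasing⇔ inc
  a∈ : a ∈ π
  a∈ = lookup τ′ (here refl)
  b∈ : b ∈ π
  b∈ = lookup τ′ (there (here refl))
  c∈ : c ∈ π
  c∈ = lookup τ′ (there (there (here refl)))
  d∈ : d ∈ π
  d∈ = lookup τ′ (there (there (there (here refl))))

Avoids-map⁺ : ∀ {f σ π} → StrictlyIncreasingOn f π → Avoids σ π → Avoids σ (map f π)
Avoids-map⁺ inc (¬c , ¬cσ) = ¬c ∘ Contains1243∨2143-map⁻ inc , ¬cσ ∘ Contains-map⁻ inc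

OrderIso-∷ʳ-view : ∀ {σ₀ y} s → All (_< y) σ₀ → OrderIso s (σ₀ ∷ʳ y) →
                   ∃₂ λ t x → s ≡ t ∷ʳ x × OrderIso t σ₀ × All (_< x) t
OrderIso-∷ʳ-view {σ₀} s σ₀<y o with initLast s
... | []       with () ← trans (proj₁ o) (length-∷ʳ σ₀)
... | t ∷ʳ′ x = t , x , refl , OrderIso-∷ʳ⁻ t σ₀ σ₀<y o

module _ {σ₀ : List ℕ} {y : ℕ} (σ₀<y : All (_< y) σ₀) (0<|σ₀| : 0 < length σ₀) where

  -- n could only be the first entry of an occurrence, but every entry lies below the last one.
  Contains-max∷⁻ : ∀ {n ρ} → All (_< n) ρ → Contains (n ∷ ρ) (σ₀ ∷ʳ y) → Contains ρ (σ₀ ∷ʳ y)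
  Contains-max∷⁻ ρ<n (s , skip _ τ , o) = s , τ , o
  Contains-max∷⁻ ρ<n (n ∷ s , refl ∷ τ , o) with OrderIso-∷ʳ-view (n ∷ s) σ₀<y o
  ... | [] , _ , _ , (l , _) , _        = ⊥-elim (<-irrefl l 0<|σ₀|)
  ... | .n ∷ t , x , refl , _ , n<x ∷ _ = ⊥-elim (<-asym n<x (All.lookup ρ<n (lookup τ (∈-∷ʳ t))))

  Avoids-max∷ : ∀ {n ρ} → All (_< n) ρ → Avoids (σ₀ ∷ʳ y) (n ∷ ρ) ⇔ Avoids (σ₀ ∷ʳ y) ρ
  Avoids-max∷ {n} {ρ} ρ<n = mk⇔
    (λ (¬c , ¬cσ) → ¬c ∘ weaken , ¬cσ ∘ λ (s , τ , o) → s , skip n τ , o)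
    (λ (¬c , ¬cσ) → ¬c ∘ strengthen , ¬cσ ∘ Contains-max∷⁻ ρ<n)
    where
    weaken : Contains1243∨2143 ρ → Contains1243∨2143 (n ∷ ρ)
    weaken (a , b , c , d , τ , r) = a , b , c , d , skip n τ , r
    strengthen : Contains1243∨2143 (n ∷ ρ) → Contains1243∨2143 ρ
    strengthen (a , b , c , d , skip _ τ , r) = a , b , c , d , τ , r
    strengthen (.n , b , c , d , refl ∷ τ , n<d , _) =
      ⊥-elim (<-asym n<d (All.lookup ρ<n (lookup τ (there (there (here refl))))))

module AvoidanceAtMaximum {σ₀ y} (σ₀<y : All (_< y) σ₀) {α β : List ℕ} {n M : ℕ}
  (uα : Unique α) (α<n : All (_< n) α) (β<n : All (_< n) β) (M∈α : M ∈ α)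
  (low : ∀ {a c} → a ∈ α → c ∈ β → a < c → a ≡ M) where

  M∷β⊆π : (M ∷ β) ⊆ α ++ n ∷ β
  M∷β⊆π = Sublist.++⁺ (from∈ M∈α) (skip n ⊆-refl)

  below⇒⊆[M] : ∀ {s x} → s ⊆ α → x ∈ β → All (_< x) s → s ⊆ M ∷ []
  below⇒⊆[M] τ x∈ s<x =
    Unique-All≡⇒⊆[ M ] (AllPairs-resp-⊆ τ uα) (All.tabulate (λ a∈ → low (lookup τ a∈) x∈ (All.lookup s<x a∈)))

  twoBelow⇒⊥ : ∀ {a b d} → (a ∷ b ∷ []) ⊆ α → d ∈ β → a < d → b < d → ⊥
  twoBelow⇒⊥ τ d∈ a<d b<d with AllPairs-resp-⊆ τ uα
  ... | (a≢b ∷ []) ∷ _ =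
    a≢b (trans (low (lookup τ (here refl)) d∈ a<d) (sym (low (lookup τ (there (here refl))) d∈ b<d)))

  -- The entries of α in such an occurrence lie below its last entry, so they can only be M.
  Contains-ending-in-β : ∀ {s₁ u x} → s₁ ⊆ α → (u ∷ʳ x) ⊆ β → All (_< x) s₁ →
                  OrderIso ((s₁ ++ u) ∷ʳ x) (σ₀ ∷ʳ y) → Contains (M ∷ β) (σ₀ ∷ʳ y)
  Contains-ending-in-β {s₁} {u} τ₁ τ₂ s₁<x o =
    _ , subst (_⊆ M ∷ β) (sym (++-assoc s₁ u _)) (Sublist.++⁺ (below⇒⊆[M] τ₁ (lookup τ₂ (∈-∷ʳ u)) s₁<x) τ₂)
      , o

  Contains-split⁻ : Contains (α ++ n ∷ β) (σ₀ ∷ʳ y) → Contains α σ₀ ⊎ Contains (M ∷ β) (σ₀ ∷ʳ y)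
  Contains-split⁻ (s , τ , o) with OrderIso-∷ʳ-view s σ₀<y o
  ... | t , x , refl , o₀ , t<x with ⊆-++⁻ α (n ∷ β) τ
  ... | s₁ , s₂ , eq , τ₁ , τ₂ with initLast s₂
  ... | [] = inj₁ (t , ∷ʳ-prefix-⊆ (subst (_⊆ α) (sym (trans eq (++-identityʳ s₁))) τ₁) , o₀)
  ... | u ∷ʳ′ x′ with ∷ʳ-injective t (s₁ ++ u) (trans eq (sym (++-assoc s₁ u (x′ ∷ []))))
  ... | refl , refl with u | τ₂
  ... | []      | skip _ τ₂′ = inj₂ (Contains-ending-in-β τ₁ τ₂′ (All.++⁻ˡ s₁ t<x) o)
  ... | []      | refl ∷ _   = inj₁ (s₁ ++ [] , subst (_⊆ α) (sym (++-identityʳ s₁)) τ₁ , o₀)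
  ... | _ ∷ _   | skip _ τ₂′ = inj₂ (Contains-ending-in-β τ₁ τ₂′ (All.++⁻ˡ s₁ t<x) o)
  ... | .n ∷ u′ | refl ∷ τ₂′ =
    ⊥-elim (<-asym (All.lookup t<x (∈-++⁺ʳ s₁ (here refl))) (All.lookup β<n (lookup τ₂′ (∈-∷ʳ u′))))

  Contains-split⁺ : Contains α σ₀ ⊎ Contains (M ∷ β) (σ₀ ∷ʳ y) → Contains (α ++ n ∷ β) (σ₀ ∷ʳ y)
  Contains-split⁺ (inj₁ (s , τ , o)) =
    s ∷ʳ n , Sublist.++⁺ τ (refl ∷ minimum β) , OrderIso-∷ʳ⁺ s σ₀ σ₀<y o (All-resp-⊆ τ α<n)
  Contains-split⁺ (inj₂ (s , τ , o)) = s , ⊆-trans τ M∷β⊆π , o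

  -- If d lies in β, then a, b < d leave room for at most one of them, M, in α.
  Contains1243∨2143-split⁻ : Contains1243∨2143 (α ++ n ∷ β) → Contains1243∨2143 α ⊎ Contains1243∨2143 (M ∷ β)
  Contains1243∨2143-split⁻ (a , b , c , d , τ , a<d , b<d , d≤c) with ⊆-++⁻ α (n ∷ β) τ
  ... | [] , _ , refl , _ , skip _ τ₂ = inj₂ (a , b , c , d , skip M τ₂ , a<d , b<d , d≤c)
  ... | [] , _ , refl , _ , refl ∷ τ₂ = ⊥-elim (<-asym a<d (All.lookup β<n (lookup τ₂ (there (there (here refl))))))
  ... | _ ∷ [] , _ , refl , τ₁ , skip _ τ₂
        with refl ← low (lookup τ₁ (here refl)) (lookup τ₂ (there (there (here refl)))) a<d =
    inj₂ (M , b , c , d , refl ∷ τ₂ , a<d , b<d , d≤c)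
  ... | _ ∷ [] , _ , refl , _ , refl ∷ τ₂ = ⊥-elim (<-asym b<d (All.lookup β<n (lookup τ₂ (there (here refl)))))
  ... | _ ∷ _ ∷ [] , _ , refl , τ₁ , skip _ τ₂ = ⊥-elim (twoBelow⇒⊥ τ₁ (lookup τ₂ (there (here refl))) a<d b<d)
  ... | _ ∷ _ ∷ [] , _ , refl , τ₁ , refl ∷ τ₂ = ⊥-elim (twoBelow⇒⊥ τ₁ (lookup τ₂ (here refl)) a<d b<d)
  ... | _ ∷ _ ∷ _ ∷ [] , _ , refl , τ₁ , skip _ τ₂ =
    ⊥-elim (twoBelow⇒⊥ (∷ʳ-prefix-⊆ τ₁) (lookup τ₂ (here refl)) a<d b<d)
  ... | _ ∷ _ ∷ _ ∷ [] , _ , refl , τ₁ , refl ∷ _ =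
    ⊥-elim (<-irrefl refl (<-≤-trans (All.lookup α<n (lookup τ₁ (there (there (here refl))))) d≤c))
  ... | _ ∷ _ ∷ _ ∷ _ ∷ [] , _ , refl , τ₁ , _ =
    inj₁ (a , b , c , d , subst (_⊆ α) (++-identityʳ _) τ₁ , a<d , b<d , d≤c)

  Contains1243∨2143-split⁺ : Contains1243∨2143 α ⊎ Contains1243∨2143 (M ∷ β) → Contains1243∨2143 (α ++ n ∷ β)
  Contains1243∨2143-split⁺ (inj₁ (a , b , c , d , τ , r)) = a , b , c , d , Sublist.++⁺ʳ (n ∷ β) τ , r
  Contains1243∨2143-split⁺ (inj₂ (a , b , c , d , τ , r)) = a , b , c , d , ⊆-trans τ M∷β⊆π , r

  Avoids-split : Avoids (σ₀ ∷ʳ y) (α ++ n ∷ β) ⇔ (Avoids σ₀ α × Avoids (σ₀ ∷ʳ y) (M ∷ β))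
  Avoids-split = mk⇔
    (λ (¬c , ¬cσ) → (¬c ∘ Contains1243∨2143-split⁺ ∘ inj₁ , ¬cσ ∘ Contains-split⁺ ∘ inj₁) ,
                    (¬c ∘ Contains1243∨2143-split⁺ ∘ inj₂ , ¬cσ ∘ Contains-split⁺ ∘ inj₂))
    (λ ((¬cα , ¬cσ₀α) , (¬cMβ , ¬cσMβ)) →
       [ ¬cα , ¬cMβ ]′ ∘ Contains1243∨2143-split⁻ , [ ¬cσ₀α , ¬cσMβ ]′ ∘ Contains-split⁻)

-- Permutations of 1, …, n

InRange : ℕ → ℕ → Set
InRange n a = 1 ≤ a × a ≤ n

record IsPerm (n : ℕ) (π : List ℕ) : Set where
  constructor isPerm
  field
    length≡ : length π ≡ n
    unique  : Unique π
    inRange : All (InRange n) π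

∈-range⁻ : ∀ {n a} → a ∈ map suc (upTo n) → InRange n a
∈-range⁻ a∈ with i , i∈ , refl ← ∈-map⁻ suc a∈ = s≤s z≤n , ∈-upTo⁻ i∈

∈-range⁺ : ∀ {n a} → InRange n a → a ∈ map suc (upTo n)
∈-range⁺ {a = suc i} (_ , i<n) = ∈-map⁺ suc (∈-upTo⁺ i<n)

words-suc : ∀ m n → words (suc m) n ≡ cartesianProductWith _∷_ (map suc (upTo n)) (words m n)
words-suc m n = concatMap≡cartesianProductWith (map suc (upTo n))
  where
  concatMap≡cartesianProductWith : ∀ as →
    concatMap (λ a → map (a ∷_) (words m n)) as ≡ cartesianProductWith _∷_ as (words m n)
  concatMap≡cartesianProductWith []       = refl
  concatMap≡cartesianProductWith (a ∷ as) = cong (map (a ∷_) (words m n) ++_) (concatMap≡cartesianProductWith as)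

∈-words : ∀ m n {w} → w ∈ words m n ⇔ (length w ≡ m × All (InRange n) w)
∈-words zero    n = mk⇔ (λ { (here refl) → refl , [] }) (λ { (refl , []) → here refl })
∈-words (suc m) n rewrite words-suc m n = mk⇔ decode encode
  where
  words′ : List (List ℕ)
  words′ = cartesianProductWith _∷_ (map suc (upTo n)) (words m n)
  decode : ∀ {w} → w ∈ words′ → length w ≡ suc m × All (InRange n) w
  decode w∈ with a , w′ , a∈ , w′∈ , refl ← ∈-cartesianProductWith⁻ _∷_ (map suc (upTo n)) (words m n) w∈ =
    let l , r = to (∈-words m n) w′∈ in cong suc l , ∈-range⁻ a∈ ∷ r
  encode : ∀ {w} → length w ≡ suc m × All (InRange n) w → w ∈ words′
  encode {a ∷ w} (l , a-range ∷ r) =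
    ∈-cartesianProductWith⁺ _∷_ (∈-range⁺ a-range) (from (∈-words m n) (suc-injective l , r))

Unique-range : ∀ n → Unique (map suc (upTo n))
Unique-range n = Unique.map⁺ suc-injective (Unique.upTo⁺ n)

Unique-words : ∀ m n → Unique (words m n)
Unique-words zero    n = [] ∷ []
Unique-words (suc m) n rewrite words-suc m n =
  Unique.cartesianProductWith⁺ _∷_ ∷-injective (Unique-range n) (Unique-words m n)

distinct⇔ : ∀ π → T (distinct π) ⇔ Unique π
distinct⇔ []      = mk⇔ (λ _ → []) _
distinct⇔ (a ∷ π) = mk⇔
  (λ t → let t₁ , t₂ = to T-∧ t in
         All.map (λ {b} → (λ ¬eq → ¬eq ∘ ≡⇒≡ᵇ a b) ∘ to (T-not (a ≡ᵇ b))) (All.all⁺ _ π t₁)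
         ∷ to (distinct⇔ π) t₂)
  (λ { (a∉ ∷ u) → from T-∧ ( All.all⁻ _ (All.map (λ {b} a≢b → from (T-not (a ≡ᵇ b)) (a≢b ∘ ≡ᵇ⇒≡ a b)) a∉)
                            , from (distinct⇔ π) u) })

∈-perms : ∀ {n π} → π ∈ perms n ⇔ IsPerm n π
∈-perms {n} {π} = mk⇔
  (λ π∈ → let π∈w , d = ∈-filter⁻ (T? ∘ distinct) π∈ in
          let l , r   = to (∈-words n n) π∈w in
          isPerm l (to (distinct⇔ π) d) r)
  (λ (isPerm l u r) → ∈-filter⁺ (T? ∘ distinct) (from (∈-words n n) (l , r)) (from (distinct⇔ π) u))

Unique-perms : ∀ n → Unique (perms n)
Unique-perms n = Unique.filter⁺ (T? ∘ distinct) (Unique-words n n)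

Avoiders : List ℕ → ℕ → List (List ℕ)
Avoiders σ n = filterᵇ (avoidsAll (p1243 ∷ p2143 ∷ σ ∷ [])) (perms n)

count : List ℕ → ℕ → ℕ
count σ n = length (Avoiders σ n)

∈-Avoiders : ∀ {σ n π} → π ∈ Avoiders σ n ⇔ (IsPerm n π × Avoids σ π)
∈-Avoiders {σ} {n} {π} = mk⇔
  (λ π∈ → let π∈p , av = ∈-filter⁻ (T? ∘ avoids) π∈ in to ∈-perms π∈p , to (avoidsAll⇔ σ π) av)
  (λ (p , av) → ∈-filter⁺ (T? ∘ avoids) (from ∈-perms p) (from (avoidsAll⇔ σ π) av))
  where avoids = avoidsAll (p1243 ∷ p2143 ∷ σ ∷ [])

Unique-Avoiders : ∀ σ n → Unique (Avoiders σ n)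
Unique-Avoiders σ n = Unique.filter⁺ (T? ∘ avoidsAll (p1243 ∷ p2143 ∷ σ ∷ [])) (Unique-perms n)

InRange⇒∈-interval : ∀ {n z} → InRange n z → z ∈ interval 1 n
InRange⇒∈-interval (1≤z , z≤bound) = ∈-interval⁺ 1≤z (s≤s z≤bound)

IsPerm-∈ : ∀ {n π v} → IsPerm n π → InRange n v → v ∈ π
IsPerm-∈ {n} {π} (isPerm l u r) v∈ =
  Unique-length-≥⇒⊇ u (Unique-interval 1 n) (InRange⇒∈-interval ∘ All.lookup r)
    (subst (_≤ length π) (sym (length-applyUpTo (1 +_) n)) (subst (n ≤_) (sym l) ≤-refl))
    (InRange⇒∈-interval v∈)

Avoiders-suc⇒∷ : ∀ {σ k τ} → τ ∈ Avoiders σ (suc k) → ∃ λ m → ∃ λ β → τ ≡ m ∷ β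
Avoiders-suc⇒∷ {σ} {k} {τ} τ∈ with τ | IsPerm.length≡ (proj₁ (to (∈-Avoiders {σ} {suc k}) τ∈))
... | m ∷ β | _ = m , β , refl

-- Decomposition at the maximum

-- inflate m b sends 1 to m and v ≥ 2 to v + b, leaving room for b further values up to b + 1;
-- deflate b inverts it on m and the values above b + 1.
inflate : ℕ → ℕ → ℕ → ℕ
inflate m b zero          = zero
inflate m b (suc zero)    = m
inflate m b (suc (suc v)) = suc (suc (v + b))

deflate : ℕ → ℕ → ℕ
deflate b a with a ≤? suc b
... | yes _ = 1
... | no  _ = a ∸ b

Inflated : ℕ → ℕ → ℕ → Set
Inflated m b a = a ≡ m ⊎ suc b < a

deflate-≤ : ∀ {b a} → a ≤ suc b → deflate b a ≡ 1
deflate-≤ {b} {a} a≤ with a ≤? suc b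
... | yes _ = refl
... | no a≰ = ⊥-elim (a≰ a≤)

deflate-> : ∀ {b a} → suc b < a → deflate b a ≡ a ∸ b
deflate-> {b} {a} b< with a ≤? suc b
... | yes a≤ = ⊥-elim (<⇒≱ b< a≤)
... | no _   = refl

inflate-Inflated : ∀ m b {v} → 0 < v → Inflated m b (inflate m b v)
inflate-Inflated m b {suc zero}    _ = inj₁ refl
inflate-Inflated m b {suc (suc v)} _ = inj₂ (s≤s (s≤s (m≤n+m b v)))

inflate-< : ∀ {m b u v} → m ≤ suc b → 0 < u → u < v → inflate m b u < inflate m b v
inflate-< {b = b} {suc zero}    {suc (suc v)} m≤ _ _                 = s≤s (≤-trans m≤ (s≤s (m≤n+m b v)))
inflate-< {b = b} {suc (suc u)} {suc (suc v)} _  _ (s≤s (s≤s u<v))  = s≤s (s≤s (+-monoˡ-< b u<v))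
inflate-< {u = suc zero} {suc zero} _ _ (s≤s ())

deflate-inflate : ∀ {m b v} → m ≤ suc b → 0 < v → deflate b (inflate m b v) ≡ v
deflate-inflate {v = suc zero}        m≤ _ = deflate-≤ m≤
deflate-inflate {b = b} {suc (suc v)} _  _ = trans (deflate-> (s≤s (s≤s (m≤n+m b v)))) (m+n∸n≡m (suc (suc v)) b)

inflate-deflate : ∀ {m b a} → m ≤ suc b → Inflated m b a → inflate m b (deflate b a) ≡ a
inflate-deflate m≤ (inj₁ refl) rewrite deflate-≤ m≤ = refl
inflate-deflate {m} {b} {suc (suc a)} _ (inj₂ (s≤s (s≤s b≤a))) = begin
  inflate m b (deflate b (2 + a)) ≡⟨ cong (inflate m b) (deflate-> (s≤s (s≤s b≤a))) ⟩
  inflate m b (2 + a ∸ b)         ≡⟨ cong (inflate m b) (+-∸-assoc 2 b≤a) ⟩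
  2 + (a ∸ b + b)                 ≡⟨ cong (2 +_) (m∸n+n≡m b≤a) ⟩
  2 + a                           ∎
  where open ≡-Reasoning

deflate-< : ∀ {m b a a′} → m ≤ suc b → Inflated m b a → Inflated m b a′ → a < a′ → deflate b a < deflate b a′
deflate-< _  (inj₁ refl) (inj₁ refl) a<a′ = ⊥-elim (<-irrefl refl a<a′)
deflate-< {b = b} {a′ = a′} m≤ (inj₁ refl) (inj₂ b<a′) _ rewrite deflate-≤ m≤ | deflate-> b<a′ =
  subst (_≤ a′ ∸ b) (m+n∸n≡m 2 b) (∸-monoˡ-≤ b b<a′)
deflate-< m≤ (inj₂ b<a) (inj₁ refl) a<a′ = ⊥-elim (<-asym a<a′ (≤-<-trans m≤ b<a))
deflate-< {b = b} _ (inj₂ b<a) (inj₂ b<a′) a<a′ rewrite deflate-> b<a | deflate-> b<a′ =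
  ∸-monoˡ-< a<a′ (≤-trans (n≤1+n b) (<⇒≤ b<a))

inflate-InRange : ∀ {m b v i} → 1 ≤ m → m ≤ suc b → InRange i v → InRange (i + b) (inflate m b v)
inflate-InRange {v = suc zero}    1≤m m≤ (_ , 1≤i) = 1≤m , ≤-trans m≤ (+-monoˡ-≤ _ 1≤i)
inflate-InRange {b = b} {suc (suc v)} _ _ (_ , v≤i) = s≤s z≤n , +-monoˡ-≤ b v≤i

deflate-InRange : ∀ {m b a i} → 1 ≤ i → m ≤ suc b → Inflated m b a → a ≤ i + b → InRange i (deflate b a)
deflate-InRange 1≤i m≤ (inj₁ refl) _ rewrite deflate-≤ m≤ = ≤-refl , 1≤i
deflate-InRange {b = b} {a} {i} _ _ (inj₂ b<a) a≤ rewrite deflate-> b<a =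
  m<n⇒0<n∸m (<-trans (n<1+n b) b<a) , subst (a ∸ b ≤_) (m+n∸n≡m i b) (∸-monoˡ-≤ b a≤)

module PermutationAtMaximum {N : ℕ} (α β : List ℕ) (perm : IsPerm N (α ++ N ∷ β)) where
  open IsPerm perm

  Unique-α : Unique α
  Unique-α = AllPairs-resp-⊆ (Sublist.++⁺ʳ (N ∷ β) ⊆-refl) unique

  Unique-N∷β : Unique (N ∷ β)
  Unique-N∷β = AllPairs-resp-⊆ (Sublist.++⁺ˡ α ⊆-refl) unique

  α∩N∷β : ∀ {a c} → a ∈ α → c ∈ N ∷ β → a ≢ c
  α∩N∷β = Unique-++-disjoint α unique

  α-InRange : All (InRange N) α
  α-InRange = All.tabulate (All.lookup inRange ∘ ∈-++⁺ˡ)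

  β-InRange : All (InRange N) β
  β-InRange = All.tabulate (All.lookup inRange ∘ ∈-++⁺ʳ α ∘ there)

  α<N : All (_< N) α
  α<N = All.tabulate λ a∈ → ≤∧≢⇒< (proj₂ (All.lookup α-InRange a∈)) (α∩N∷β a∈ (here refl))

  β<N : All (_< N) β
  β<N with N∉β ∷ _ ← Unique-N∷β =
    All.tabulate λ c∈ → ≤∧≢⇒< (proj₂ (All.lookup β-InRange c∈)) (All.lookup N∉β c∈ ∘ sym)

  length-α+β : length α + suc (length β) ≡ N
  length-α+β = trans (sym (length-++ α)) length≡

  module Avoiding (¬1243∨2143 : ¬ Contains1243∨2143 (α ++ N ∷ β)) {M} (M∈α : M ∈ α) (M≤α : All (M ≤_) α) where

    M<α∖M : ∀ {a} → a ∈ α → a ≢ M → M < a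
    M<α∖M a∈ a≢M = ≤∧≢⇒< (All.lookup M≤α a∈) (a≢M ∘ sym)

    -- Otherwise M, a, N, c would be an occurrence of 1243 or 2143.
    low : ∀ {a c} → a ∈ α → c ∈ β → a < c → a ≡ M
    low {a} {c} a∈ c∈ a<c with a ≟ M
    ... | yes a≡M = a≡M
    ... | no a≢M  with ∈-pair-⊆ M∈α a∈ (a≢M ∘ sym)
    ... | inj₁ τ = ⊥-elim (¬1243∨2143 (M , a , N , c , Sublist.++⁺ τ (refl ∷ from∈ c∈) ,
                                       <-trans (M<α∖M a∈ a≢M) a<c , a<c , <⇒≤ (All.lookup β<N c∈)))
    ... | inj₂ τ = ⊥-elim (¬1243∨2143 (a , M , N , c , Sublist.++⁺ τ (refl ∷ from∈ c∈) ,
                                       a<c , <-trans (M<α∖M a∈ a≢M) a<c , <⇒≤ (All.lookup β<N c∈)))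

    β<α∖M : ∀ {a c} → a ∈ α → a ≢ M → c ∈ β → c < a
    β<α∖M {a} {c} a∈ a≢M c∈ with <-cmp c a
    ... | tri< c<a _ _ = c<a
    ... | tri≈ _ c≡a _ = ⊥-elim (α∩N∷β a∈ (there c∈) (sym c≡a))
    ... | tri> _ _ a<c = ⊥-elim (a≢M (low a∈ c∈ a<c))

    Unique-M∷β : Unique (M ∷ β)
    Unique-M∷β with _ ∷ uβ ← Unique-N∷β = All.tabulate (α∩N∷β M∈α ∘ there) ∷ uβ

    -- The values 1, …, x all lie in M ∷ β.
    ≤1+|β| : ∀ {x} → x < N → (∀ {a} → a ∈ α → a ≢ M → x < a) → x ≤ suc (length β)
    ≤1+|β| {x} x<N x<α∖M =
      subst (_≤ suc (length β)) (length-applyUpTo (1 +_) x) (Unique-length-≤ (Unique-interval 1 x) Unique-M∷β ⊆M∷β)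
      where
      ⊆M∷β : ∀ {v} → v ∈ interval 1 x → v ∈ M ∷ β
      ⊆M∷β {v} v∈ with ∈-interval⁻ v∈
      ... | 1≤v , v<1+x with ∈-++⁻ α (IsPerm-∈ perm (1≤v , ≤-trans (≤-pred v<1+x) (<⇒≤ x<N)))
      ... | inj₂ (here refl) = ⊥-elim (<-irrefl refl (≤-<-trans (≤-pred v<1+x) x<N))
      ... | inj₂ (there v∈β) = there v∈β
      ... | inj₁ v∈α with v ≟ M
      ...   | yes refl = here refl
      ...   | no v≢M   = ⊥-elim (<⇒≱ (x<α∖M v∈α v≢M) (≤-pred v<1+x))

    M≤1+|β| : M ≤ suc (length β)
    M≤1+|β| = ≤1+|β| (All.lookup α<N M∈α) M<α∖M

    β≤1+|β| : All (_≤ suc (length β)) β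
    β≤1+|β| = All.tabulate λ c∈ → ≤1+|β| (All.lookup β<N c∈) (λ a∈ a≢M → β<α∖M a∈ a≢M c∈)

    -- M ∷ β consists of 1 + length β distinct values below any other a ∈ α.
    α-Inflated : All (Inflated M (length β)) α
    α-Inflated = All.tabulate case
      where
      case : ∀ {a} → a ∈ α → Inflated M (length β) a
      case {a} a∈ with a ≟ M
      ... | yes a≡M = inj₁ a≡M
      ... | no a≢M  = inj₂ (subst (_≤ a) (+-comm (suc (length β)) 1)
                       (length-≤-interval (proj₁ (All.lookup α-InRange a∈)) Unique-M∷β (All.tabulate bounds)))
        where
        bounds : ∀ {z} → z ∈ M ∷ β → 1 ≤ z × z < a
        bounds (here refl) = proj₁ (All.lookup α-InRange M∈α) , M<α∖M a∈ a≢M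
        bounds (there c∈)  = proj₁ (All.lookup β-InRange c∈) , β<α∖M a∈ a≢M c∈

min-∷ : ∀ {M a α} → M ∈ a ∷ α → All (M ≤_) (a ∷ α) → min a α ≡ M
min-∷ {α = α} M∈ (M≤a ∷ M≤α) = ≤-antisym (min≤M M∈) (v≤min⁺ M≤a M≤α)
  where
  min≤M : ∀ {M a} → M ∈ a ∷ α → min a α ≤ M
  min≤M (here refl) = min≤⊤ _ α
  min≤M (there M∈α) = min≤v⁺ _ α (inj₂ (lose M∈α ≤-refl))

min-∈ : ∀ a α → min a α ∈ a ∷ α
min-∈ a α with argmin-sel (λ x → x) a α
... | inj₁ min≡a = here min≡a
... | inj₂ min∈α = there min∈α

breakAt : ℕ → List ℕ → List ℕ × List ℕ
breakAt N []      = [] , []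
breakAt N (x ∷ π) with x ≟ N
... | yes _ = [] , π
... | no  _ = map₁ (x ∷_) (breakAt N π)

breakAt-++ : ∀ {N} α β → N ∉ α → breakAt N (α ++ N ∷ β) ≡ (α , β)
breakAt-++ {N} []      β _ with N ≟ N
... | yes _   = refl
... | no N≢N = ⊥-elim (N≢N refl)
breakAt-++ {N} (a ∷ α) β N∉ with a ≟ N
... | yes refl = ⊥-elim (N∉ (here refl))
... | no  _    = cong (map₁ (a ∷_)) (breakAt-++ α β (N∉ ∘ there))

Piece : Set
Piece = List ℕ ⊎ (List ℕ × List ℕ)

-- A permutation with maximum N is N ∷ ρ, or α ++ N ∷ β with α ≠ [] encoded by the standardisation s of α
-- and m ∷ β, where m = min α. An empty second component never occurs; glue sends it to [].
glue : ℕ → Piece → List ℕ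
glue N (inj₁ ρ)           = N ∷ ρ
glue N (inj₂ (s , []))    = []
glue N (inj₂ (s , m ∷ β)) = map (inflate m (length β)) s ++ N ∷ β

unglue : List ℕ × List ℕ → Piece
unglue ([]    , β) = inj₁ β
unglue (a ∷ α , β) = inj₂ (map (deflate (length β)) (a ∷ α) , min a α ∷ β)

decompose : ℕ → List ℕ → Piece
decompose N π = unglue (breakAt N π)

splitsAt : List ℕ → List ℕ → ℕ → ℕ → List (List ℕ × List ℕ)
splitsAt σ₀ σ N i = cartesianProduct (Avoiders σ₀ i) (Avoiders σ (N ∸ i))

splits : List ℕ → List ℕ → ℕ → List (List ℕ × List ℕ)
splits σ₀ σ n = concatMap (splitsAt σ₀ σ (suc n)) (map suc (downFrom n))

Pieces : List ℕ → List ℕ → ℕ → List Piece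
Pieces σ₀ σ n = map inj₁ (Avoiders σ n) ++ map inj₂ (splits σ₀ σ n)

∈-downRange⁻ : ∀ {n i} → i ∈ map suc (downFrom n) → 1 ≤ i × i ≤ n
∈-downRange⁻ i∈ with j , j∈ , refl ← ∈-map⁻ suc i∈ = s≤s z≤n , ∈-downFrom⁻ j∈

∈-downRange⁺ : ∀ {n i} → 1 ≤ i → i ≤ n → i ∈ map suc (downFrom n)
∈-downRange⁺ {i = suc j} _ j<n = ∈-map⁺ suc (∈-downFrom⁺ j<n)

∈-splits⁻ : ∀ {σ₀ σ n s τ} → (s , τ) ∈ splits σ₀ σ n →
            ∃ λ i → (1 ≤ i × i ≤ n) × s ∈ Avoiders σ₀ i × τ ∈ Avoiders σ (suc n ∸ i)
∈-splits⁻ {σ₀} {σ} {n} p∈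
  with i , i∈ , p∈ᵢ ← find (∈-concatMap⁻ (splitsAt σ₀ σ (suc n)) {xs = map suc (downFrom n)} p∈) =
  i , ∈-downRange⁻ i∈ , ∈-cartesianProduct⁻ (Avoiders σ₀ i) (Avoiders σ (suc n ∸ i)) p∈ᵢ

∈-splits⁺ : ∀ {σ₀ σ n s τ i} → 1 ≤ i → i ≤ n → s ∈ Avoiders σ₀ i → τ ∈ Avoiders σ (suc n ∸ i) →
            (s , τ) ∈ splits σ₀ σ n
∈-splits⁺ {σ₀} {σ} {n} 1≤i i≤n s∈ τ∈ =
  ∈-concatMap⁺ (splitsAt σ₀ σ (suc n)) (lose (∈-downRange⁺ 1≤i i≤n) (∈-cartesianProduct⁺ s∈ τ∈))

Unique-splits : ∀ σ₀ σ n → Unique (splits σ₀ σ n)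
Unique-splits σ₀ σ n =
  Unique-concatMap⁺ (splitsAt σ₀ σ (suc n)) (length ∘ proj₁) (Unique.map⁺ suc-injective (Unique.downFrom⁺ n))
    (λ {i} _ → Unique.cartesianProduct⁺ (Unique-Avoiders σ₀ i) (Unique-Avoiders σ (suc n ∸ i)))
    (λ {i} _ p∈ → IsPerm.length≡ (proj₁ (to ∈-Avoiders (proj₁ (∈-cartesianProduct⁻ (Avoiders σ₀ i) _ p∈)))))

Unique-Pieces : ∀ σ₀ σ n → Unique (Pieces σ₀ σ n)
Unique-Pieces σ₀ σ n =
  Unique.++⁺ (Unique.map⁺ inj₁-injective (Unique-Avoiders σ n))
             (Unique.map⁺ inj₂-injective (Unique-splits σ₀ σ n))
             (λ (p , q) → case (∈-map⁻ inj₁ p) (∈-map⁻ inj₂ q))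
  where
  case : ∀ {x : Piece} → (∃ λ ρ → _ × x ≡ inj₁ ρ) → (∃ λ p → _ × x ≡ inj₂ p) → _
  case (_ , _ , refl) (_ , _ , ())

length-Pieces : ∀ σ₀ σ n → length (Pieces σ₀ σ n) ≡
  count σ n + sum (map (λ i → count σ₀ i * count σ (suc n ∸ i)) (map suc (downFrom n)))
length-Pieces σ₀ σ n = begin
  length (map inj₁ (Avoiders σ n) ++ map inj₂ (splits σ₀ σ n))
    ≡⟨ length-++ (map inj₁ (Avoiders σ n)) ⟩
  length (map inj₁ (Avoiders σ n)) + length (map inj₂ (splits σ₀ σ n))
    ≡⟨ cong₂ _+_ (length-map inj₁ (Avoiders σ n)) (length-map inj₂ (splits σ₀ σ n)) ⟩
  count σ n + length (splits σ₀ σ n)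
    ≡⟨ cong (count σ n +_) (length-concatMap _ (map suc (downFrom n))) ⟩
  count σ n + sum (map (length ∘ splitsAt σ₀ σ (suc n)) (map suc (downFrom n)))
    ≡⟨ cong (λ xs → count σ n + sum xs)
            (map-cong (λ i → length-cartesianProduct (Avoiders σ₀ i) _) (map suc (downFrom n))) ⟩
  count σ n + sum (map (λ i → count σ₀ i * count σ (suc n ∸ i)) (map suc (downFrom n))) ∎
  where open ≡-Reasoning

unglue-∷ : ∀ {α β M} → 0 < length α → M ∈ α → All (M ≤_) α →
           unglue (α , β) ≡ inj₂ (map (deflate (length β)) α , M ∷ β)
unglue-∷ {a ∷ α} {β} _ M∈ M≤ = cong (λ m → inj₂ (map (deflate (length β)) (a ∷ α) , m ∷ β)) (min-∷ M∈ M≤)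

module Recurrence {σ₀ : List ℕ} {y : ℕ} (σ₀<y : All (_< y) σ₀) (0<|σ₀| : 0 < length σ₀) (n : ℕ) where

  N : ℕ
  N = suc n

  σ : List ℕ
  σ = σ₀ ∷ʳ y

  module Glue {i s m β} (1≤i : 1 ≤ i) (i≤n : i ≤ n)
              (s∈ : s ∈ Avoiders σ₀ i) (τ∈ : (m ∷ β) ∈ Avoiders σ (N ∸ i)) where

    b : ℕ
    b = length β

    ps : IsPerm i s
    ps = proj₁ (to ∈-Avoiders s∈)

    pτ : IsPerm (N ∸ i) (m ∷ β)
    pτ = proj₁ (to ∈-Avoiders τ∈)

    i+1+b≡N : i + suc b ≡ N
    i+1+b≡N = trans (cong (i +_) (IsPerm.length≡ pτ)) (m+[n∸m]≡n (m≤n⇒m≤1+n i≤n))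

    τ-InRange : All (InRange (suc b)) (m ∷ β)
    τ-InRange = subst (λ k → All (InRange k) (m ∷ β)) (sym (IsPerm.length≡ pτ)) (IsPerm.inRange pτ)

    1≤m : 1 ≤ m
    1≤m = proj₁ (All.head τ-InRange)

    m≤1+b : m ≤ suc b
    m≤1+b = proj₂ (All.head τ-InRange)

    b<N : suc b < N
    b<N = subst (suc b <_) i+1+b≡N (+-monoˡ-≤ (suc b) 1≤i)

    β<N : All (_< N) β
    β<N = All.map (λ c-range → ≤-<-trans (proj₂ c-range) b<N) (All.tail τ-InRange)

    s-positive : ∀ {v} → v ∈ s → 1 ≤ v
    s-positive = proj₁ ∘ All.lookup (IsPerm.inRange ps)

    α : List ℕ
    α = map (inflate m b) s

    inflate-increasing : StrictlyIncreasingOn (inflate m b) s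
    inflate-increasing u∈ _ = inflate-< m≤1+b (s-positive u∈)

    α-Inflated : All (Inflated m b) α
    α-Inflated = All.map⁺ (All.tabulate (inflate-Inflated m b ∘ s-positive))

    i+b<N : i + b < N
    i+b<N = subst (i + b <_) (trans (sym (+-suc i b)) i+1+b≡N) (n<1+n _)

    α-InRange : All (InRange (i + b)) α
    α-InRange = All.map⁺ (All.map (inflate-InRange 1≤m m≤1+b) (IsPerm.inRange ps))

    α<N : All (_< N) α
    α<N = All.map (λ (_ , a≤i+b) → ≤-<-trans a≤i+b i+b<N) α-InRange

    m∈α : m ∈ α
    m∈α = ∈-map⁺ (inflate m b) (IsPerm-∈ ps (≤-refl , 1≤i))

    Unique-α : Unique α
    Unique-α = Unique-map-leftInverse (inflate m b) (deflate b) (deflate-inflate m≤1+b ∘ s-positive) (IsPerm.unique ps)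

    low : ∀ {a c} → a ∈ α → c ∈ β → a < c → a ≡ m
    low a∈ c∈ a<c with All.lookup α-Inflated a∈
    ... | inj₁ a≡m = a≡m
    ... | inj₂ b<a = ⊥-elim (<-asym a<c (≤-<-trans (proj₂ (All.lookup (All.tail τ-InRange) c∈)) b<a))

    β-InRange : All (InRange N) β
    β-InRange = All.map (λ (1≤c , c≤) → 1≤c , <⇒≤ (≤-<-trans c≤ b<N)) (All.tail τ-InRange)

    Unique-N∷β : Unique (N ∷ β)
    Unique-N∷β with _ ∷ uβ ← IsPerm.unique pτ = All.map (λ c<N → <⇒≢ c<N ∘ sym) β<N ∷ uβ

    α∩N∷β : ∀ {z} → z ∈ α × z ∈ N ∷ β → ⊥
    α∩N∷β (z∈α , here refl) = <-irrefl refl (All.lookup α<N z∈α)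
    α∩N∷β (z∈α , there z∈β) with All.lookup α-Inflated z∈α | IsPerm.unique pτ
    ... | inj₁ refl | m∉β ∷ _ = All.lookup m∉β z∈β refl
    ... | inj₂ b<z  | _       = <⇒≱ b<z (proj₂ (All.lookup (All.tail τ-InRange) z∈β))

    perm : IsPerm N (α ++ N ∷ β)
    perm = isPerm
      (trans (length-++ α) (trans (cong (_+ suc b) (trans (length-map _ s) (IsPerm.length≡ ps))) i+1+b≡N))
      (Unique.++⁺ Unique-α Unique-N∷β α∩N∷β)
      (All.++⁺ (All.zipWith (λ ((1≤a , _) , a<N) → 1≤a , <⇒≤ a<N) (α-InRange , α<N))
               ((s≤s z≤n , ≤-refl) ∷ β-InRange))

    avoids : Avoids σ (α ++ N ∷ β)
    avoids = from (AvoidanceAtMaximum.Avoids-split σ₀<y Unique-α α<N β<N m∈α low)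
                  ( Avoids-map⁺ inflate-increasing (proj₂ (to (∈-Avoiders {σ₀} {i}) s∈))
                  , proj₂ (to (∈-Avoiders {σ} {N ∸ i}) τ∈))

    glue-∈ : glue N (inj₂ (s , m ∷ β)) ∈ Avoiders σ N
    glue-∈ = from ∈-Avoiders (perm , avoids)

    decompose-glue : decompose N (glue N (inj₂ (s , m ∷ β))) ≡ inj₂ (s , m ∷ β)
    decompose-glue = begin
      unglue (breakAt N (α ++ N ∷ β))
        ≡⟨ cong unglue (breakAt-++ α β (<-irrefl refl ∘ All.lookup α<N)) ⟩
      unglue (α , β)
        ≡⟨ unglue-∷ 0<|α| m∈α (All.map m≤ α-Inflated) ⟩
      inj₂ (map (deflate b) α , m ∷ β)
        ≡⟨ cong (λ s′ → inj₂ (s′ , m ∷ β)) (map-leftInverse _ _ (deflate-inflate m≤1+b ∘ s-positive)) ⟩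
      inj₂ (s , m ∷ β) ∎
      where
      open ≡-Reasoning
      0<|α| : 0 < length α
      0<|α| = subst (0 <_) (sym (trans (length-map _ s) (IsPerm.length≡ ps))) 1≤i
      m≤ : ∀ {a} → Inflated m b a → m ≤ a
      m≤ (inj₁ refl) = ≤-refl
      m≤ (inj₂ b<a)  = <⇒≤ (≤-<-trans m≤1+b b<a)

  module Unglue {a α′ β} (π∈ : (a ∷ α′) ++ N ∷ β ∈ Avoiders σ N) where

    α : List ℕ
    α = a ∷ α′

    b : ℕ
    b = length β

    perm : IsPerm N (α ++ N ∷ β)
    perm = proj₁ (to (∈-Avoiders {σ} {N}) π∈)

    av : Avoids σ (α ++ N ∷ β)
    av = proj₂ (to (∈-Avoiders {σ} {N}) π∈)

    open PermutationAtMaximum α β perm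

    M : ℕ
    M = min a α′

    M∈α : M ∈ α
    M∈α = min-∈ a α′

    M≤α : All (M ≤_) α
    M≤α = min≤⊤ a α′ ∷ min≤xs a α′

    ¬1243∨2143 : ¬ Contains1243∨2143 (α ++ N ∷ β)
    ¬1243∨2143 = proj₁ av

    open Avoiding ¬1243∨2143 M∈α M≤α

    avoids : Avoids σ₀ α × Avoids σ (M ∷ β)
    avoids = to (AvoidanceAtMaximum.Avoids-split σ₀<y Unique-α α<N β<N M∈α low) av

    inflated : ∀ {a} → a ∈ α → Inflated M b a
    inflated = All.lookup α-Inflated

    i : ℕ
    i = length α

    i≤n : i ≤ n
    i≤n = subst (i ≤_) (suc-injective (trans (sym (+-suc i b)) length-α+β)) (m≤m+n i b)

    s : List ℕ
    s = map (deflate b) α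

    s∈ : s ∈ Avoiders σ₀ i
    s∈ = from ∈-Avoiders
      ( isPerm (length-map _ α)
               (Unique-map-leftInverse (deflate b) (inflate M b) (inflate-deflate M≤1+|β| ∘ inflated) Unique-α)
               (All.map⁺ (All.tabulate λ a∈ →
                  deflate-InRange (s≤s z≤n) M≤1+|β| (inflated a∈) (a≤i+b a∈)))
      , Avoids-map⁺ (λ u∈ v∈ → deflate-< M≤1+|β| (inflated u∈) (inflated v∈)) (proj₁ avoids))
      where
      a≤i+b : ∀ {a} → a ∈ α → a ≤ i + b
      a≤i+b {a} a∈ = ≤-pred (subst (a <_) (trans (sym length-α+β) (+-suc i b)) (All.lookup α<N a∈))

    τ∈ : (M ∷ β) ∈ Avoiders σ (N ∸ i)
    τ∈ = subst (λ k → (M ∷ β) ∈ Avoiders σ k) (trans (sym (m+n∸m≡n i (suc b))) (cong (_∸ i) length-α+β))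
      (from ∈-Avoiders
        ( isPerm refl Unique-M∷β
            ((proj₁ (All.lookup α-InRange M∈α) , M≤1+|β|) ∷
             All.zipWith (λ (r , c≤) → proj₁ r , c≤) (β-InRange , β≤1+|β|))
        , proj₂ avoids))

    decompose-∈ : decompose N (α ++ N ∷ β) ∈ Pieces σ₀ σ n
    decompose-∈ rewrite breakAt-++ α β (<-irrefl refl ∘ All.lookup α<N) =
      ∈-++⁺ʳ (map inj₁ (Avoiders σ n)) (∈-map⁺ inj₂ (∈-splits⁺ (s≤s z≤n) i≤n s∈ τ∈))

    glue-decompose : glue N (decompose N (α ++ N ∷ β)) ≡ α ++ N ∷ β
    glue-decompose rewrite breakAt-++ α β (<-irrefl refl ∘ All.lookup α<N) =
      cong (_++ N ∷ β) (map-leftInverse (deflate b) (inflate M b) (inflate-deflate M≤1+|β| ∘ inflated))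

  N∷-∈ : ∀ {ρ} → ρ ∈ Avoiders σ n → (N ∷ ρ) ∈ Avoiders σ N
  N∷-∈ {ρ} ρ∈ with isPerm l u r , av ← to (∈-Avoiders {σ} {n}) ρ∈ =
    from ∈-Avoiders
      ( isPerm (cong suc l) (All.map (λ (_ , c≤n) → <⇒≢ (s≤s c≤n) ∘ sym) r ∷ u)
               ((s≤s z≤n , ≤-refl) ∷ All.map (λ (1≤c , c≤n) → 1≤c , m≤n⇒m≤1+n c≤n) r)
      , from (Avoids-max∷ σ₀<y 0<|σ₀| (All.map (s≤s ∘ proj₂) r)) av)

  N∷-∈⁻ : ∀ {ρ} → (N ∷ ρ) ∈ Avoiders σ N → ρ ∈ Avoiders σ n
  N∷-∈⁻ {ρ} π∈ with isPerm l (N∉ρ ∷ u) (_ ∷ r) , av ← to (∈-Avoiders {σ} {N}) π∈ =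
    from ∈-Avoiders
      ( isPerm (suc-injective l) u (All.zipWith (λ ((1≤c , _) , c<N) → 1≤c , ≤-pred c<N) (r , ρ<N))
      , to (Avoids-max∷ σ₀<y 0<|σ₀| ρ<N) av)
    where
    ρ<N : All (_< N) ρ
    ρ<N = All.zipWith (λ ((_ , c≤N) , N≢c) → ≤∧≢⇒< c≤N (N≢c ∘ sym)) (r , N∉ρ)

  data PieceView : Piece → Set where
    whole : ∀ {ρ} → ρ ∈ Avoiders σ n → PieceView (inj₁ ρ)
    split : ∀ {i s m β} → 1 ≤ i → i ≤ n → s ∈ Avoiders σ₀ i → (m ∷ β) ∈ Avoiders σ (N ∸ i) →
            PieceView (inj₂ (s , m ∷ β))

  pieceView : ∀ {x} → x ∈ Pieces σ₀ σ n → PieceView x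
  pieceView x∈ with ∈-++⁻ (map inj₁ (Avoiders σ n)) x∈
  ... | inj₁ p with _ , ρ∈ , refl ← ∈-map⁻ inj₁ p = whole ρ∈
  ... | inj₂ p with (_ , τ) , st∈ , refl ← ∈-map⁻ inj₂ p
               with i , (1≤i , i≤n) , s∈ , τ∈ ← ∈-splits⁻ {σ₀} {σ} {n} st∈
               with _ , _ , refl ← Avoiders-suc⇒∷ {σ} {n ∸ i} (subst (τ ∈_) (cong (Avoiders σ) (+-∸-assoc 1 i≤n)) τ∈)
               =
    split 1≤i i≤n s∈ τ∈

  glue-∈ : ∀ {x} → x ∈ Pieces σ₀ σ n → glue N x ∈ Avoiders σ N
  glue-∈ x∈ with pieceView x∈
  ... | whole ρ∈              = N∷-∈ ρ∈
  ... | split 1≤i i≤n s∈ τ∈ = Glue.glue-∈ 1≤i i≤n s∈ τ∈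

  decompose-glue : ∀ {x} → x ∈ Pieces σ₀ σ n → decompose N (glue N x) ≡ x
  decompose-glue x∈ with pieceView x∈
  ... | whole {ρ} _           = cong unglue (breakAt-++ {N} [] ρ λ ())
  ... | split 1≤i i≤n s∈ τ∈ = Glue.decompose-glue 1≤i i≤n s∈ τ∈

  glue-onto : ∀ {π} → π ∈ Avoiders σ N → ∃ λ x → x ∈ Pieces σ₀ σ n × glue N x ≡ π
  glue-onto π∈ with ∈-∃++ (IsPerm-∈ (proj₁ (to (∈-Avoiders {σ} {N}) π∈)) (s≤s z≤n , ≤-refl))
  ... | []     , β , refl = inj₁ β , ∈-++⁺ˡ (∈-map⁺ inj₁ (N∷-∈⁻ π∈)) , refl
  ... | _ ∷ _ , _ , refl = _ , Unglue.decompose-∈ π∈ , Unglue.glue-decompose π∈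

  count-suc : count σ N ≡
    count σ n + sum (map (λ i → count σ₀ i * count σ (N ∸ i)) (map suc (downFrom n)))
  count-suc = trans (sym (length-≡-bijection (glue N) (decompose N) (Unique-Pieces σ₀ σ n) (Unique-Avoiders σ N)
                                              glue-∈ glue-onto decompose-glue))
                    (length-Pieces σ₀ σ n)

-- The families 12⋯k and 213⋯k

incr-∷ʳ : ∀ k → incr (suc k) ≡ incr k ∷ʳ suc k
incr-∷ʳ k = trans (cong (map suc) (sym (applyUpTo-∷ʳ (λ i → i) k))) (map-++ suc (upTo k) (k ∷ []))

incr-< : ∀ k → All (_< suc k) (incr k)
incr-< k = All.tabulate λ x∈ → s≤s (proj₂ (∈-range⁻ x∈))

p213-∷ʳ : ∀ k → p213 (3 + k) ≡ p213 (2 + k) ∷ʳ (3 + k)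
p213-∷ʳ k = cong (λ xs → 2 ∷ 1 ∷ xs)
  (trans (cong (map (3 +_)) (sym (applyUpTo-∷ʳ (λ i → i) k))) (map-++ (3 +_) (upTo k) (k ∷ [])))

p213-< : ∀ k → All (_< 3 + k) (p213 (2 + k))
p213-< k = s≤s (s≤s (s≤s z≤n)) ∷ s≤s (s≤s z≤n) ∷
           All.tabulate λ x∈ → let i , i∈ , x≡ = ∈-map⁻ (3 +_) x∈ in
                               subst (_< 3 + k) (sym x≡) (+-monoʳ-< 3 (∈-upTo⁻ i∈))

count-zero : ∀ {σ} → 0 < length σ → count σ 0 ≡ 1
count-zero {_ ∷ _} _ = refl

count-1 : ∀ n → count (1 ∷ []) (suc n) ≡ 0
count-1 n = cong length (∄∈⇒≡[] λ π∈ → ¬avoids-1 (to (∈-Avoiders {1 ∷ []} {suc n}) π∈))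
  where
  ¬avoids-1 : ∀ {π} → IsPerm (suc n) π × Avoids (1 ∷ []) π → ⊥
  ¬avoids-1 {x ∷ π} (_ , _ , ¬c) = ¬c (x ∷ [] , refl ∷ minimum π , refl , [] ∷ [])

incr-sorted : ∀ n → AllPairs _<_ (incr n)
incr-sorted n = AllPairs.map⁺ (AllPairs.applyUpTo⁺₁ (λ i → i) n (λ i<j _ → s<s i<j))

IsPerm-incr : ∀ n → IsPerm n (incr n)
IsPerm-incr n = isPerm (trans (length-map suc (upTo n)) (length-upTo n)) (Unique-range n) (All.tabulate ∈-range⁻)

incr-∈-Avoiders-21 : ∀ n → incr n ∈ Avoiders (2 ∷ 1 ∷ []) n
incr-∈-Avoiders-21 n = from ∈-Avoiders (IsPerm-incr n , ¬1243∨2143 , ¬c21)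
  where
  ¬1243∨2143 : ¬ Contains1243∨2143 (incr n)
  ¬1243∨2143 (a , b , c , d , τ , _ , _ , d≤c) with AllPairs-resp-⊆ τ (incr-sorted n)
  ... | _ ∷ _ ∷ (c<d ∷ []) ∷ _ = <⇒≱ c<d d≤c
  ¬c21 : ¬ Contains (incr n) (2 ∷ 1 ∷ [])
  ¬c21 (x ∷ y ∷ [] , τ , _ , (x<y⇔2<1 ∷ []) ∷ _) with AllPairs-resp-⊆ τ (incr-sorted n)
  ... | (x<y ∷ []) ∷ _ = ≤⇒≯ (n≤1+n 1) (to x<y⇔2<1 x<y)

avoids21⇒incr : ∀ n {π} → IsPerm n π → ¬ Contains π (2 ∷ 1 ∷ []) → π ≡ incr n
avoids21⇒incr zero    {[]} _ _ = refl
avoids21⇒incr (suc n) perm ¬c21 with ∈-∃++ (IsPerm-∈ perm (s≤s z≤n , ≤-refl))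
... | α , c ∷ β , refl =
  ⊥-elim (¬c21 (suc n ∷ c ∷ [] , Sublist.++⁺ˡ α (refl ∷ refl ∷ minimum β) , refl ,
                (neither (<-asym (All.lookup (PermutationAtMaximum.β<N α (c ∷ β) perm) (here refl)))
                         (≤⇒≯ (n≤1+n 1)) ∷ []) ∷ [] ∷ []))
... | α , [] , refl = trans (cong (_∷ʳ suc n) (avoids21⇒incr n permα (¬c21 ∘ extend))) (sym (incr-∷ʳ n))
  where
  open PermutationAtMaximum α [] perm
  permα : IsPerm n α
  permα = isPerm (suc-injective (trans (sym (+-comm (length α) 1)) length-α+β)) Unique-α
                 (All.zipWith (λ ((1≤a , _) , a<N) → 1≤a , ≤-pred a<N) (α-InRange , α<N))
  extend : Contains α (2 ∷ 1 ∷ []) → Contains (α ∷ʳ suc n) (2 ∷ 1 ∷ [])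
  extend (s , τ , o) = s , Sublist.++⁺ʳ (suc n ∷ []) τ , o

count-21 : ∀ n → count (2 ∷ 1 ∷ []) n ≡ 1
count-21 n = ≤-antisym
  (Sublist.length-mono-≤ (Unique-All≡⇒⊆[ incr n ] (Unique-Avoiders (2 ∷ 1 ∷ []) n)
     (All.tabulate λ π∈ → let perm , _ , ¬c21 = to (∈-Avoiders {2 ∷ 1 ∷ []} {n}) π∈ in
                           avoids21⇒incr n perm ¬c21)))
  (∈-length (incr-∈-Avoiders-21 n))

CountRecurrence : (ℕ → List ℕ) → ℕ → Set
CountRecurrence family k = ∀ n →
  count (family (suc (suc k))) (suc n) ≡
  count (family (suc (suc k))) n +
  sum (map (λ i → count (family (suc k)) i * count (family (suc (suc k))) (suc n ∸ i)) (map suc (downFrom n)))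

recurrence-∷ʳ : ∀ (family : ℕ → List ℕ) {k y} → family (suc (suc k)) ≡ family (suc k) ∷ʳ y →
                All (_< y) (family (suc k)) → 0 < length (family (suc k)) → CountRecurrence family k
recurrence-∷ʳ family {k} eq below nonempty n rewrite eq = Recurrence.count-suc below nonempty n

incr-recurrence : ∀ k → CountRecurrence incr k
incr-recurrence k = recurrence-∷ʳ incr (incr-∷ʳ (suc k)) (incr-< (suc k)) (s≤s z≤n)

-- 213⋯k for k = 2 is 21, which does not end in its maximum; only the identity avoids it.
p213-recurrence : ∀ k → CountRecurrence p213 k
p213-recurrence (suc k) = recurrence-∷ʳ p213 (p213-∷ʳ k) (p213-< k) (s≤s z≤n)
p213-recurrence zero n rewrite count-21 (suc n) | count-21 n = cong suc (sym (no-products n))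
  where
  no-products : ∀ j → sum (map (λ i → count (1 ∷ []) i * count (2 ∷ 1 ∷ []) (suc n ∸ i)) (map suc (downFrom j)))
                      ≡ 0
  no-products zero    = refl
  no-products (suc j) rewrite count-1 j = no-products j

theorem6p5 : (k : ℕ) → 1 ≤ k →
    ((n : ℕ) → conv (minusOne (gf (countAvoiders (p1243 ∷ p2143 ∷ incr k ∷ [])))) (chebQ k) n
                 ≡ shift (chebQ (k ∸ 1)) n)
    × ((n : ℕ) → conv (minusOne (gf (countAvoiders (p1243 ∷ p2143 ∷ p213 k ∷ [])))) (chebQ k) n
                 ≡ shift (chebQ (k ∸ 1)) n)
theorem6p5 k 1≤k =
  gf-conv-chebQ (count ∘ incr) (λ k → count-zero {incr (suc k)} (s≤s z≤n)) count-1 incr-recurrence k 1≤k ,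
  gf-conv-chebQ (count ∘ p213) p213-zero count-1 p213-recurrence k 1≤k
  where
  p213-zero : ∀ k → count (p213 (suc k)) 0 ≡ 1
  p213-zero zero    = refl
  p213-zero (suc k) = refl
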